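{- Let $A=(V,\mathcal{E})$ be a finite tree. Each of the following three properties (i), (ii), (iii) characterizes one and the same tricoloring $(B,\mathcal{R},G)$ of $A$; that is, there is exactly one tricoloring of $A$ satisfying (i), exactly one satisfying (ii), exactly one satisfying (iii), and these three tricolorings coincide. (i) (Minimal vertex covers.) $B$ is the positive vertex-backbone of $A$; $\mathcal{R}$ is the set of exclusive edges of $A$; $G$ is the negative vertex-backbone of $A$. (ii) (Maximal matchings.) $B$ is the set of unavoidable vertices of $A$; $\mathcal{R}$ is the positive edge-backbone of $A$; $G$ is the set of optional vertices of $A$. (iii) The edges in $\mathcal{R}$ are pairwise non-adjacent; every edge with one end-vertex in $G$ has its other end-vertex in $B$; each vertex in $B$ is joined to vertices of $G$ by at least two edges.
   Context: Graphs are simple (no loops, no multiple edges). A tricoloring of a graph $A=(V,\mathcal{E})$ is a triple $(B,\mathcal{R},G)$ with $B\subseteq V$, $\mathcal{R}\subseteq\mathcal{E}$, $G\subseteq V$, such that $B$, $G$ and the set of end-vertices of edges in $\mathcal{R}$ form a partition of $V$ (some parts may be empty). A vertex cover of $A$ is a subset of $V$ containing at least one end of each edge; a minimal vertex cover is one of smallest cardinality. The positive (resp. negative) vertex-backbone is the set of vertices belonging to every (resp. to no) minimal vertex cover. Vertices in neither backbone are called degenerate. An edge between two degenerate vertices is called exclusive if no minimal vertex cover contains both of its end-vertices. A matching of $A$ is a set of pairwise non-adjacent edges; a maximal matching is one of largest cardinality. The positive (resp. negative) edge-backbone is the set of edges belonging to every (resp. to no) maximal matching. A vertex is optional if there is a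 maximal matching none of whose edges has it as an end-vertex. A vertex is unavoidable if it is neither optional nor an end-vertex of an edge of the positive edge-backbone. -}

module Defs where

open import Data.Nat using (ℕ; _≤_; _≥_)
open import Data.Fin using (Fin)
open import Data.Fin.Subset using (Subset; _∈_; _∉_; ∣_∣)
open import Data.Product using (Σ; ∃; _×_; _,_; proj₁; proj₂)
open import Data.Sum using (_⊎_)
open import Data.List using (List; []; _∷_; _++_; [_]; length)
open import Data.List.Relation.Unary.Linked using (Linked)
open import Data.List.Relation.Unary.Unique.Propositional using (Unique)
open import Relation.Binary.PropositionalEquality using (_≡_; _≢_)
open import Relation.Nullary using (¬_)
open import Function.Bundles using (_⇔_)

-- Edge e has end-vertices proj₁ (ends e) and proj₂ (ends e); no loops, and
-- distinct labels give distinct unordered pairs (no multiple edges).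
record Graph (n m : ℕ) : Set where
  field
    ends     : Fin m → Fin n × Fin n
    loopless : ∀ e → proj₁ (ends e) ≢ proj₂ (ends e)
    simple   : ∀ e f →
               (ends e ≡ ends f ⊎ ends e ≡ (proj₂ (ends f) , proj₁ (ends f))) →
               e ≡ f

module _ {n m : ℕ} (A : Graph n m) where
  open Graph A

  end₁ end₂ : Fin m → Fin n
  end₁ e = proj₁ (ends e)
  end₂ e = proj₂ (ends e)

  Incident : Fin n → Fin m → Set
  Incident v e = v ≡ end₁ e ⊎ v ≡ end₂ e

  Adj : Fin n → Fin n → Set
  Adj u v = ∃ λ e → ends e ≡ (u , v) ⊎ ends e ≡ (v , u)

  data Walk : Fin n → Fin n → Set where
    here : ∀ {v} → Walk v v
    step : ∀ {u w v} → Adj u w → Walk w v → Walk u v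

  Connected : Set
  Connected = ∀ u v → Walk u v

  Cycle : List (Fin n) → Set
  Cycle [] = Data.Empty.⊥ where import Data.Empty
  Cycle (v ∷ ws) = length (v ∷ ws) ≥ 3 × Unique (v ∷ ws) × Linked Adj (v ∷ ws ++ [ v ])

  Acyclic : Set
  Acyclic = ∀ vs → ¬ Cycle vs

  IsTree : Set
  IsTree = Connected × Acyclic

  Tricol : Set
  Tricol = Subset n × Subset m × Subset n

  EndOf : Subset m → Fin n → Set
  EndOf R v = ∃ λ e → e ∈ R × Incident v e

  IsTricoloring : Tricol → Set
  IsTricoloring (B , R , G) =
    (∀ v → v ∈ B ⊎ EndOf R v ⊎ v ∈ G) ×
    (∀ v → v ∈ B → ¬ EndOf R v) ×
    (∀ v → v ∈ B → v ∉ G) ×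
    (∀ v → EndOf R v → v ∉ G)

  VertexCover : Subset n → Set
  VertexCover C = ∀ e → end₁ e ∈ C ⊎ end₂ e ∈ C

  MinVertexCover : Subset n → Set
  MinVertexCover C = VertexCover C × (∀ C′ → VertexCover C′ → ∣ C ∣ ≤ ∣ C′ ∣)

  PosVBackbone : Fin n → Set
  PosVBackbone v = ∀ C → MinVertexCover C → v ∈ C

  NegVBackbone : Fin n → Set
  NegVBackbone v = ∀ C → MinVertexCover C → v ∉ C

  Degenerate : Fin n → Set
  Degenerate v = ¬ PosVBackbone v × ¬ NegVBackbone v

  Exclusive : Fin m → Set
  Exclusive e = Degenerate (end₁ e) × Degenerate (end₂ e) ×
                (∀ C → MinVertexCover C → ¬ (end₁ e ∈ C × end₂ e ∈ C))

  PairwiseNonAdjacent : Subset m → Set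
  PairwiseNonAdjacent M = ∀ e f → e ∈ M → f ∈ M → e ≢ f →
                          ∀ v → Incident v e → ¬ Incident v f

  Matching : Subset m → Set
  Matching = PairwiseNonAdjacent

  MaxMatching : Subset m → Set
  MaxMatching M = Matching M × (∀ M′ → Matching M′ → ∣ M′ ∣ ≤ ∣ M ∣)

  PosEBackbone : Fin m → Set
  PosEBackbone e = ∀ M → MaxMatching M → e ∈ M

  Optional : Fin n → Set
  Optional v = ∃ λ M → MaxMatching M × (∀ e → e ∈ M → ¬ Incident v e)

  Unavoidable : Fin n → Set
  Unavoidable v = ¬ Optional v × ¬ (∃ λ e → PosEBackbone e × Incident v e)

  Prop-i : Tricol → Set
  Prop-i (B , R , G) = (∀ v → (v ∈ B) ⇔ PosVBackbone v) ×
                       (∀ e → (e ∈ R) ⇔ Exclusive e) ×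
                       (∀ v → (v ∈ G) ⇔ NegVBackbone v)

  Prop-ii : Tricol → Set
  Prop-ii (B , R , G) = (∀ v → (v ∈ B) ⇔ Unavoidable v) ×
                        (∀ e → (e ∈ R) ⇔ PosEBackbone e) ×
                        (∀ v → (v ∈ G) ⇔ Optional v)

  JoinsToG : Subset n → Fin n → Fin m → Set
  JoinsToG G v e = (end₁ e ≡ v × end₂ e ∈ G) ⊎ (end₂ e ≡ v × end₁ e ∈ G)

  Prop-iii : Tricol → Set
  Prop-iii (B , R , G) =
    PairwiseNonAdjacent R ×
    (∀ e → (end₁ e ∈ G → end₂ e ∈ B) × (end₂ e ∈ G → end₁ e ∈ B)) ×
    (∀ v → v ∈ B → ∃ λ e → ∃ λ f → e ≢ f × JoinsToG G v e × JoinsToG G v f)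

-- A tricoloring with (iii) is built by stripping leaves: an isolated
-- vertex goes to G; for a leaf ℓ with neighbour p, colour the rest first, then put p in B and ℓ in G
-- if p already has a neighbour in G, and put the edge ℓp in R otherwise.
-- Conversely, let (B, R, G) satisfy (iii). Stripping leaves again yields, for every g₀, a matching N
-- of B into G ∖ {g₀} saturating B, and, for suitable q₁ and q₂, a set K of red vertices containing
-- them, containing exactly one end of each edge of R and covering all edges between red vertices.
-- Then R ∪ N is a matching and B ∪ K a vertex cover of no larger size, so both are optimal, and
-- complementary slackness (a minimum cover contains exactly one end of each edge of a maximum matching,
-- and each of its vertices is matched) identifies the backbones, which gives (i) and (ii). As (i)
-- determines a tricoloring, each of the three properties singles out the same one.

module Submission where

open import Defs
open import Data.Empty using (⊥-elim)
open import Data.Fin using (Fin; zero; suc; _≟_)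
open import Data.Fin.Properties using (any?; 0≢1+n; suc-injective)
open import Data.Fin.Subset
  using (Subset; _∈_; _∉_; _⊆_; _⊂_; ∣_∣; _-_; _∪_; ∁; ⁅_⁆; inside; outside)
  renaming (⊥ to ∅; ⊤ to full)
open import Data.Fin.Subset.Induction using (Acc; acc; ⊂-wellFounded)
open import Data.Fin.Subset.Properties
  using ( _∈?_; nonempty?; ∈⊤; ∉⊥; x∈⁅x⁆; x∈⁅y⁆⇒x≡y; x∈p∪q⁺; x∈p∪q⁻
        ; x∈p∧x≢y⇒x∈p-y; p─q⊆p; x∈p⇒p-x⊂p; x∈p⇒∣p-x∣<∣p∣; ⊆-⊂-trans; ⊆-antisym
        ; x∈∁p⇒x∉p; x∉p⇒x∈∁p)
open import Data.List using (List; []; _∷_; _++_; [_]; length)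
open import Data.List.Membership.Propositional using () renaming (_∈_ to _∈ₗ_)
import Data.List.Relation.Unary.All as All
open import Data.List.Relation.Unary.All using ([]; _∷_)
open import Data.List.Relation.Unary.AllPairs using ([]; _∷_)
open import Data.List.Relation.Unary.Any using (here; there)
open import Data.List.Relation.Unary.Linked using (Linked; [-]; _∷_)
open import Data.List.Relation.Unary.Unique.Propositional using (Unique)
open import Data.Nat using (ℕ; _≤_; _<_; s≤s; z≤n)
open import Data.Nat.Properties using (≤-trans; <-≤-trans; ≤⇒≯)
open import Data.Product using (Σ; ∃-syntax; _×_; _,_; proj₁; proj₂)
open import Data.Sum using (_⊎_; inj₁; inj₂; [_,_]′)
open import Data.Vec using ([]; _∷_; here; there)
open import Function.Bundles using (_⇔_; mk⇔; Equivalence)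
open import Relation.Binary.PropositionalEquality using (_≡_; _≢_; refl; sym; trans; subst; cong₂; ≢-sym)
open import Relation.Nullary using (¬_; yes; no)
open import Relation.Nullary.Decidable using (Dec; _×-dec_; _⊎-dec_; ¬?)

x∉p-x : ∀ {k} (p : Subset k) (x : Fin k) → x ∉ p - x
x∉p-x (_ ∷ _) zero ()
x∉p-x (_ ∷ p) (suc x) (there x∈p-x) = x∉p-x p x x∈p-x

module _ {k : ℕ} where

  x∈p-y⁻ : ∀ {p : Subset k} {x y} → x ∈ p - y → x ∈ p × x ≢ y
  x∈p-y⁻ {p} {y = y} x∈p-y = p─q⊆p p ⁅ y ⁆ x∈p-y , λ { refl → x∉p-x p y x∈p-y }

  x∈p⇒x∈p∪⁅y⁆ : ∀ {p : Subset k} {x y} → x ∈ p → x ∈ p ∪ ⁅ y ⁆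
  x∈p⇒x∈p∪⁅y⁆ x∈p = x∈p∪q⁺ (inj₁ x∈p)

  y∈p∪⁅y⁆ : ∀ {p : Subset k} {y} → y ∈ p ∪ ⁅ y ⁆
  y∈p∪⁅y⁆ {y = y} = x∈p∪q⁺ (inj₂ (x∈⁅x⁆ y))

  x∈p∪⁅y⁆⁻ : ∀ {p : Subset k} {x y} → x ∈ p ∪ ⁅ y ⁆ → x ∈ p ⊎ x ≡ y
  x∈p∪⁅y⁆⁻ {p} {y = y} x∈ with x∈p∪q⁻ p ⁅ y ⁆ x∈
  ... | inj₁ x∈p = inj₁ x∈p
  ... | inj₂ x∈⁅y⁆ = inj₂ (x∈⁅y⁆⇒x≡y y x∈⁅y⁆)

  x∈p-y-z⁻ : ∀ {p : Subset k} {x y z} → x ∈ p - y - z → x ∈ p × x ≢ y × x ≢ z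
  x∈p-y-z⁻ x∈ = let (x∈p-y , x≢z) = x∈p-y⁻ x∈ ; (x∈p , x≢y) = x∈p-y⁻ x∈p-y in x∈p , x≢y , x≢z

  x∈p-y-z⁺ : ∀ {p : Subset k} {x y z} → x ∈ p → x ≢ y → x ≢ z → x ∈ p - y - z
  x∈p-y-z⁺ x∈p x≢y x≢z = x∈p∧x≢y⇒x∈p-y (x∈p∧x≢y⇒x∈p-y x∈p x≢y) x≢z

  x∈p⇒x≡y⊎x≡z⊎x∈p-y-z : ∀ {p : Subset k} {x} y z → x ∈ p → x ≡ y ⊎ x ≡ z ⊎ x ∈ p - y - z
  x∈p⇒x≡y⊎x≡z⊎x∈p-y-z {x = x} y z x∈p with x ≟ y | x ≟ z
  ... | yes x≡y | _ = inj₁ x≡y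
  ... | no _ | yes x≡z = inj₂ (inj₁ x≡z)
  ... | no x≢y | no x≢z = inj₂ (inj₂ (x∈p-y-z⁺ x∈p x≢y x≢z))

  p-x-y⊂p : ∀ {p : Subset k} {x} y → x ∈ p → p - x - y ⊂ p
  p-x-y⊂p {p} {x} y x∈p = ⊆-⊂-trans (p─q⊆p (p - x) ⁅ y ⁆) (x∈p⇒p-x⊂p x∈p)

  ⇔-unique : ∀ {P : Fin k → Set} {p q : Subset k} →
             (∀ x → (x ∈ p) ⇔ P x) → (∀ x → (x ∈ q) ⇔ P x) → p ≡ q
  ⇔-unique p⇔P q⇔P =
    ⊆-antisym (λ {x} x∈p → Equivalence.from (q⇔P x) (Equivalence.to (p⇔P x) x∈p))
              (λ {x} x∈q → Equivalence.from (p⇔P x) (Equivalence.to (q⇔P x) x∈q))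

record _↪_ {a b : ℕ} (X : Subset a) (Y : Subset b) : Set where
  field
    image     : ∀ {x} → x ∈ X → Fin b
    image∈    : ∀ {x} (x∈X : x ∈ X) → image x∈X ∈ Y
    injective : ∀ {x y} (x∈X : x ∈ X) (y∈X : y ∈ X) → image x∈X ≡ image y∈X → x ≡ y

module _ {a b : ℕ} {Y : Subset b} where
  open _↪_

  ↪-tail : ∀ {s} {X : Subset a} → (s ∷ X) ↪ Y → X ↪ Y
  ↪-tail ι = record
    { image     = λ x∈X → image ι (there x∈X)
    ; image∈    = λ x∈X → image∈ ι (there x∈X)
    ; injective = λ x∈X y∈X eq → suc-injective (injective ι (there x∈X) (there y∈X) eq)
    }

  ↪-avoiding : ∀ {X : Subset a} {y} (ι : X ↪ Y) → (∀ {x} (x∈X : x ∈ X) → image ι x∈X ≢ y) → X ↪ (Y - y)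
  ↪-avoiding ι misses = record
    { image     = image ι
    ; image∈    = λ x∈X → x∈p∧x≢y⇒x∈p-y (image∈ ι x∈X) (misses x∈X)
    ; injective = injective ι
    }

↪⇒∣≤∣ : ∀ {a b} {X : Subset a} {Y : Subset b} → X ↪ Y → ∣ X ∣ ≤ ∣ Y ∣
↪⇒∣≤∣ {X = []} ι = z≤n
↪⇒∣≤∣ {X = outside ∷ X} ι = ↪⇒∣≤∣ (↪-tail ι)
↪⇒∣≤∣ {X = inside ∷ X} ι =
  <-≤-trans (s≤s (↪⇒∣≤∣ (↪-avoiding (↪-tail ι) head-not-hit))) (x∈p⇒∣p-x∣<∣p∣ (image∈ here))
  where
  open _↪_ ι
  head-not-hit : ∀ {x} (x∈X : x ∈ X) → image (there x∈X) ≢ image here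
  head-not-hit x∈X eq = 0≢1+n (sym (injective (there x∈X) here eq))

↪-missing⇒∣<∣ : ∀ {a b} {X : Subset a} {Y : Subset b} {y} (ι : X ↪ Y) → y ∈ Y →
                (∀ {x} (x∈X : x ∈ X) → _↪_.image ι x∈X ≢ y) → ∣ X ∣ < ∣ Y ∣
↪-missing⇒∣<∣ ι y∈Y misses = <-≤-trans (s≤s (↪⇒∣≤∣ (↪-avoiding ι misses))) (x∈p⇒∣p-x∣<∣p∣ y∈Y)

module _ {X : Set} where

  prefix-to : ∀ {w : X} xs → w ∈ₗ xs → List X
  prefix-to (x ∷ _) (here _) = [ x ]
  prefix-to (x ∷ xs) (there w∈xs) = x ∷ prefix-to xs w∈xs

  All-prefix-to : ∀ {P : X → Set} {w xs} (w∈xs : w ∈ₗ xs) → All.All P xs → All.All P (prefix-to xs w∈xs)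
  All-prefix-to (here _) (px ∷ _) = px ∷ []
  All-prefix-to (there w∈xs) (px ∷ pxs) = px ∷ All-prefix-to w∈xs pxs

  Unique-prefix-to : ∀ {w xs} (w∈xs : w ∈ₗ xs) → Unique xs → Unique (prefix-to xs w∈xs)
  Unique-prefix-to (here _) (_ ∷ _) = [] ∷ []
  Unique-prefix-to (there w∈xs) (x∉xs ∷ uxs) = All-prefix-to w∈xs x∉xs ∷ Unique-prefix-to w∈xs uxs

  Linked-prefix-to : ∀ {R : X → X → Set} {w b c xs} (w∈xs : w ∈ₗ xs) →
                     Linked R (c ∷ xs) → R w b → Linked R (c ∷ prefix-to xs w∈xs ++ [ b ])
  Linked-prefix-to {xs = _ ∷ _} (here refl) (rcx ∷ _) rwb = rcx ∷ rwb ∷ [-]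
  Linked-prefix-to {xs = _ ∷ _ ∷ _} (there w∈xs) (rcx ∷ linked) rwb = rcx ∷ Linked-prefix-to w∈xs linked rwb

  1≤length-prefix-to : ∀ {w xs} (w∈xs : w ∈ₗ xs) → 1 ≤ length (prefix-to xs w∈xs)
  1≤length-prefix-to (here _) = s≤s z≤n
  1≤length-prefix-to (there _) = s≤s z≤n

no-back-edge : ∀ {n m} (A : Graph n m) → Acyclic A → ∀ {v x w} xs →
               Unique (v ∷ x ∷ xs) → Linked (Adj A) (v ∷ x ∷ xs) → w ∈ₗ xs → ¬ Adj A w v
no-back-edge A acyclic {v} {x} xs unique linked w∈xs w~v =
  acyclic (v ∷ x ∷ prefix-to xs w∈xs)
    ( s≤s (s≤s (1≤length-prefix-to w∈xs))
    , Unique-prefix-to (there (there w∈xs)) unique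
    , Linked-prefix-to (there w∈xs) linked w~v )

module Edges {n m : ℕ} (A : Graph n m) where
  open Graph A

  Incident? : ∀ v e → Dec (Incident A v e)
  Incident? v e = (v ≟ end₁ A e) ⊎-dec (v ≟ end₂ A e)

  other : ∀ {v e} → Incident A v e → Fin n
  other {e = e} (inj₁ _) = end₂ A e
  other {e = e} (inj₂ _) = end₁ A e

  other-incident : ∀ {v e} (v∈e : Incident A v e) → Incident A (other v∈e) e
  other-incident (inj₁ _) = inj₂ refl
  other-incident (inj₂ _) = inj₁ refl

  other≢ : ∀ {v e} (v∈e : Incident A v e) → other v∈e ≢ v
  other≢ {e = e} (inj₁ refl) eq = loopless e (sym eq)
  other≢ {e = e} (inj₂ refl) eq = loopless e eq

  ≢other : ∀ {v e} (v∈e : Incident A v e) → v ≢ other v∈e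
  ≢other v∈e = ≢-sym (other≢ v∈e)

  other-Adj : ∀ {v e} (v∈e : Incident A v e) → Adj A (other v∈e) v
  other-Adj {e = e} (inj₁ refl) = e , inj₂ refl
  other-Adj {e = e} (inj₂ refl) = e , inj₁ refl

  ≡-other : ∀ {v w e} (v∈e : Incident A v e) → Incident A w e → w ≢ v → w ≡ other v∈e
  ≡-other (inj₁ refl) (inj₁ w≡v) w≢v = ⊥-elim (w≢v w≡v)
  ≡-other (inj₁ refl) (inj₂ w≡) _ = w≡
  ≡-other (inj₂ refl) (inj₁ w≡) _ = w≡
  ≡-other (inj₂ refl) (inj₂ w≡v) w≢v = ⊥-elim (w≢v w≡v)

  incident-cases : ∀ {v w e} (v∈e : Incident A v e) → Incident A w e → w ≡ v ⊎ w ≡ other v∈e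
  incident-cases {v} {w} v∈e w∈e with w ≟ v
  ... | yes w≡v = inj₁ w≡v
  ... | no w≢v = inj₂ (≡-other v∈e w∈e w≢v)

  both-ends : ∀ {P : Fin n → Set} {v w e} → Incident A v e → Incident A w e → v ≢ w →
              P v → P w → P (end₁ A e) × P (end₂ A e)
  both-ends (inj₁ refl) (inj₁ refl) v≢w _ _ = ⊥-elim (v≢w refl)
  both-ends (inj₁ refl) (inj₂ refl) _ pv pw = pv , pw
  both-ends (inj₂ refl) (inj₁ refl) _ pv pw = pw , pv
  both-ends (inj₂ refl) (inj₂ refl) v≢w _ _ = ⊥-elim (v≢w refl)

  JoinsToG? : ∀ G v e → Dec (JoinsToG A G v e)
  JoinsToG? G v e = ((end₁ A e ≟ v) ×-dec (end₂ A e ∈? G)) ⊎-dec ((end₂ A e ≟ v) ×-dec (end₁ A e ∈? G))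

  joins-other : ∀ {G v e} (v∈e : Incident A v e) → other v∈e ∈ G → JoinsToG A G v e
  joins-other (inj₁ refl) o∈G = inj₁ (refl , o∈G)
  joins-other (inj₂ refl) o∈G = inj₂ (refl , o∈G)

  joins⁻ : ∀ {G v e} → JoinsToG A G v e → Σ (Incident A v e) λ v∈e → other v∈e ∈ G
  joins⁻ (inj₁ (refl , o∈G)) = inj₁ refl , o∈G
  joins⁻ (inj₂ (refl , o∈G)) = inj₂ refl , o∈G

  JoinsTwice : Subset n → Fin n → Set
  JoinsTwice G v = ∃[ e ] ∃[ f ] e ≢ f × JoinsToG A G v e × JoinsToG A G v f

  joins-mono : ∀ {G G′ v e} → G ⊆ G′ → JoinsToG A G v e → JoinsToG A G′ v e
  joins-mono G⊆G′ (inj₁ (eq , o∈G)) = inj₁ (eq , G⊆G′ o∈G)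
  joins-mono G⊆G′ (inj₂ (eq , o∈G)) = inj₂ (eq , G⊆G′ o∈G)

  JoinsTwice-mono : ∀ {G G′ v} → G ⊆ G′ → JoinsTwice G v → JoinsTwice G′ v
  JoinsTwice-mono G⊆G′ (e , f , e≢f , joins-e , joins-f) =
    e , f , e≢f , joins-mono G⊆G′ joins-e , joins-mono G⊆G′ joins-f

  ends-incident⇒≡ : ∀ {e f} → Incident A (end₁ A e) f → Incident A (end₂ A e) f → e ≡ f
  ends-incident⇒≡ {e} (inj₁ e₁≡) (inj₁ e₂≡) = ⊥-elim (loopless e (trans e₁≡ (sym e₂≡)))
  ends-incident⇒≡ {e} {f} (inj₁ e₁≡) (inj₂ e₂≡) = simple e f (inj₁ (cong₂ _,_ e₁≡ e₂≡))
  ends-incident⇒≡ {e} {f} (inj₂ e₁≡) (inj₁ e₂≡) = simple e f (inj₂ (cong₂ _,_ e₁≡ e₂≡))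
  ends-incident⇒≡ {e} (inj₂ e₁≡) (inj₂ e₂≡) = ⊥-elim (loopless e (trans e₁≡ (sym e₂≡)))

  edge-unique : ∀ {u w e f} → u ≢ w → Incident A u e → Incident A w e →
                Incident A u f → Incident A w f → e ≡ f
  edge-unique {f = f} u≢w u∈e w∈e u∈f w∈f =
    let (e₁∈f , e₂∈f) = both-ends {P = λ z → Incident A z f} u∈e w∈e u≢w u∈f w∈f
    in ends-incident⇒≡ e₁∈f e₂∈f

-- Leaves of induced subforests

module Leaves {n m : ℕ} (A : Graph n m) (acyclic : Acyclic A) (W : Subset n) where
  open Edges A

  Inside : Fin m → Set
  Inside e = end₁ A e ∈ W × end₂ A e ∈ W

  Isolated : Fin n → Set
  Isolated v = ∀ e → Inside e → ¬ Incident A v e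

  Leaf : Fin n → Set
  Leaf ℓ = ∃[ e ] Inside e × Incident A ℓ e × (∀ f → Inside f → Incident A ℓ f → f ≡ e)

  Inside? : ∀ e → Dec (Inside e)
  Inside? e = (end₁ A e ∈? W) ×-dec (end₂ A e ∈? W)

  inside-edge : ∀ {v w e} → Incident A v e → Incident A w e → v ≢ w → v ∈ W → w ∈ W → Inside e
  inside-edge = both-ends

  other∈W : ∀ {v e} (v∈e : Incident A v e) → Inside e → other v∈e ∈ W
  other∈W (inj₁ _) (_ , e₂∈W) = e₂∈W
  other∈W (inj₂ _) (e₁∈W , _) = e₁∈W

  private
    Complement : Subset n → List (Fin n) → Set
    Complement U xs = ∀ x → (x ∉ U → x ∈ₗ xs) × (x ∈ₗ xs → x ∉ U)

    complement-full : Complement full []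
    complement-full x = (λ x∉full → ⊥-elim (x∉full ∈⊤)) , λ ()

    complement-extend : ∀ {U w xs} → w ∈ U → Complement U xs → Complement (U - w) (w ∷ xs)
    complement-extend {U} {w} {xs} w∈U compl x = to , from
      where
      to : x ∉ U - w → x ∈ₗ w ∷ xs
      to x∉ with x ≟ w
      ... | yes x≡w = here x≡w
      ... | no x≢w = there (proj₁ (compl x) (λ x∈U → x∉ (x∈p∧x≢y⇒x∈p-y x∈U x≢w)))
      from : x ∈ₗ w ∷ xs → x ∉ U - w
      from (here refl) = x∉p-x U w
      from (there x∈xs) x∈ = proj₂ (compl x) x∈xs (proj₁ (x∈p-y⁻ x∈))

    -- The path is listed from its current end v, and U is the set of unvisited vertices. A second
    -- edge at v leads either to an unvisited vertex, extending the path, or back into it, closing a cycle.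
    walk : ∀ {U} → Acc _⊂_ U → ∀ {u v p e} rest → v ∈ W → Inside e → Incident A v e → Incident A p e →
           Unique (v ∷ p ∷ rest) → Linked (Adj A) (v ∷ p ∷ rest) → Complement U (v ∷ p ∷ rest) →
           u ∈ₗ p ∷ rest → ∃[ ℓ ] ℓ ∈ W × ℓ ≢ u × Leaf ℓ
    walk {U} (acc smaller) {u} {v} {p} {e} rest v∈W e-in v∈e p∈e
         unique@((v≢p ∷ v∉rest) ∷ _) linked compl u∈
      with any? (λ f → Inside? f ×-dec Incident? v f ×-dec ¬? (f ≟ e))
    ... | no no-second-edge = v , v∈W , All.lookup (v≢p ∷ v∉rest) u∈ , e , e-in , v∈e , only-e
      where
      only-e : ∀ f → Inside f → Incident A v f → f ≡ e
      only-e f f-in v∈f with f ≟ e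
      ... | yes f≡e = f≡e
      ... | no f≢e = ⊥-elim (no-second-edge (f , f-in , v∈f , f≢e))
    ... | yes (f , f-in , v∈f , f≢e) with other v∈f ∈? U
    ...   | yes w∈U =
            walk (smaller (x∈p⇒p-x⊂p w∈U)) (p ∷ rest) (other∈W v∈f f-in) f-in (other-incident v∈f) v∈f
                 (All.tabulate (λ {x} x∈ w≡x → proj₂ (compl x) x∈ (subst (_∈ U) w≡x w∈U)) ∷ unique)
                 (other-Adj v∈f ∷ linked) (complement-extend w∈U compl) (there u∈)
    ...   | no w∉U = ⊥-elim (no-back-edge A acyclic rest unique linked w∈rest (other-Adj v∈f))
      where
      w∈rest : other v∈f ∈ₗ rest
      w∈rest with proj₁ (compl _) w∉U
      ... | here w≡v = ⊥-elim (other≢ v∈f w≡v)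
      ... | there (here w≡p) =
              ⊥-elim (f≢e (edge-unique v≢p v∈f (subst (λ z → Incident A z f) w≡p (other-incident v∈f)) v∈e p∈e))
      ... | there (there w∈rest) = w∈rest

  leaf-or-isolated : ∀ {u} → u ∈ W → Isolated u ⊎ ∃[ ℓ ] ℓ ∈ W × ℓ ≢ u × Leaf ℓ
  leaf-or-isolated {u} u∈W with any? (λ f → Inside? f ×-dec Incident? u f)
  ... | no none = inj₁ (λ e e-in u∈e → none (e , e-in , u∈e))
  ... | yes (f , f-in , u∈f) =
        inj₂ (walk (⊂-wellFounded _) [] (other∈W u∈f f-in) f-in (other-incident u∈f) u∈f
                   ((other≢ u∈f ∷ []) ∷ [] ∷ []) (other-Adj u∈f ∷ [-])
                   (complement-extend (x∈p∧x≢y⇒x∈p-y ∈⊤ (other≢ u∈f)) (complement-extend ∈⊤ complement-full))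
                   (here refl))

  some-leaf : ∀ {u} → u ∈ W → ¬ Isolated u → ∃[ ℓ ] ℓ ∈ W × Leaf ℓ
  some-leaf u∈W u-not-isolated with leaf-or-isolated u∈W
  ... | inj₁ u-isolated = ⊥-elim (u-not-isolated u-isolated)
  ... | inj₂ (ℓ , ℓ∈W , _ , leaf) = ℓ , ℓ∈W , leaf

  leaf-avoiding : ∀ {u} → u ∈ W → ¬ Isolated u → ∀ v → ∃[ ℓ ] ℓ ∈ W × ℓ ≢ v × Leaf ℓ
  leaf-avoiding u∈W u-not-isolated v with v ∈? W | some-leaf u∈W u-not-isolated
  ... | no v∉W | ℓ , ℓ∈W , leaf = ℓ , ℓ∈W , (λ { refl → v∉W ℓ∈W }) , leaf
  ... | yes v∈W | ℓ , ℓ∈W , leaf@(e , e-in , ℓ∈e , _) with leaf-or-isolated v∈W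
  ...   | inj₁ v-isolated = ℓ , ℓ∈W , (λ { refl → v-isolated e e-in ℓ∈e }) , leaf
  ...   | inj₂ leaf-avoiding-v = leaf-avoiding-v

-- Existence of a tricoloring with property (iii)

module Existence {n m : ℕ} (A : Graph n m) (acyclic : Acyclic A) where
  open Graph A
  open Edges A

  record TricoloringOn (S B : Subset n) (R : Subset m) (G : Subset n) : Set where
    field
      partition       : ∀ v → v ∈ S → v ∈ B ⊎ EndOf A R v ⊎ v ∈ G
      B∌end           : ∀ v → v ∈ B → ¬ EndOf A R v
      B∌G             : ∀ v → v ∈ B → v ∉ G
      end∉G           : ∀ v → EndOf A R v → v ∉ G
      B⊆S             : B ⊆ S
      end∈S           : ∀ {v} → EndOf A R v → v ∈ S
      G⊆S             : G ⊆ S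
      R-matching      : PairwiseNonAdjacent A R
      G-neighbour∈B   : ∀ {e x y} → Incident A x e → Incident A y e → x ≢ y → x ∈ S → y ∈ S → x ∈ G → y ∈ B
      B-joins-G-twice : ∀ v → v ∈ B → JoinsTwice G v

  tricoloring-on-∅ : ∀ {S} → (∀ v → v ∉ S) → TricoloringOn S ∅ ∅ ∅
  tricoloring-on-∅ S-empty = record
    { partition       = λ v v∈S → ⊥-elim (S-empty v v∈S)
    ; B∌end           = λ _ v∈∅ → ⊥-elim (∉⊥ v∈∅)
    ; B∌G             = λ _ v∈∅ → ⊥-elim (∉⊥ v∈∅)
    ; end∉G           = λ _ _ v∈∅ → ∉⊥ v∈∅
    ; B⊆S             = λ v∈∅ → ⊥-elim (∉⊥ v∈∅)
    ; end∈S           = λ (_ , e∈∅ , _) → ⊥-elim (∉⊥ e∈∅)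
    ; G⊆S             = λ v∈∅ → ⊥-elim (∉⊥ v∈∅)
    ; R-matching      = λ _ _ e∈∅ → ⊥-elim (∉⊥ e∈∅)
    ; G-neighbour∈B   = λ _ _ _ x∈S → ⊥-elim (S-empty _ x∈S)
    ; B-joins-G-twice = λ _ v∈∅ → ⊥-elim (∉⊥ v∈∅)
    }

  module _ {S ℓ} (ℓ∈S : ℓ ∈ S) (ℓ-isolated : Leaves.Isolated A acyclic S ℓ) where
    open Leaves A acyclic S using (inside-edge)

    add-isolated : ∀ {B R G} → TricoloringOn (S - ℓ) B R G → TricoloringOn S B R (G ∪ ⁅ ℓ ⁆)
    add-isolated {B} {R} {G} c = record
      { partition       = partition′
      ; B∌end           = B∌end
      ; B∌G             = B∌G′
      ; end∉G           = end∉G′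
      ; B⊆S             = λ v∈B → ⊆S (B⊆S v∈B)
      ; end∈S           = λ end → ⊆S (end∈S end)
      ; G⊆S             = G′⊆S
      ; R-matching      = R-matching
      ; G-neighbour∈B   = G-neighbour∈B′
      ; B-joins-G-twice = λ v v∈B → JoinsTwice-mono x∈p⇒x∈p∪⁅y⁆ (B-joins-G-twice v v∈B)
      }
      where
      open TricoloringOn c
      ⊆S : ∀ {v} → v ∈ S - ℓ → v ∈ S
      ⊆S v∈ = proj₁ (x∈p-y⁻ v∈)
      ≢ℓ : ∀ {v} → v ∈ S - ℓ → v ≢ ℓ
      ≢ℓ v∈ = proj₂ (x∈p-y⁻ v∈)
      partition′ : ∀ v → v ∈ S → v ∈ B ⊎ EndOf A R v ⊎ v ∈ G ∪ ⁅ ℓ ⁆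
      partition′ v v∈S with v ≟ ℓ
      ... | yes refl = inj₂ (inj₂ y∈p∪⁅y⁆)
      ... | no v≢ℓ with partition v (x∈p∧x≢y⇒x∈p-y v∈S v≢ℓ)
      ...   | inj₁ v∈B = inj₁ v∈B
      ...   | inj₂ (inj₁ end) = inj₂ (inj₁ end)
      ...   | inj₂ (inj₂ v∈G) = inj₂ (inj₂ (x∈p⇒x∈p∪⁅y⁆ v∈G))
      B∌G′ : ∀ v → v ∈ B → v ∉ G ∪ ⁅ ℓ ⁆
      B∌G′ v v∈B v∈ with x∈p∪⁅y⁆⁻ v∈
      ... | inj₁ v∈G = B∌G v v∈B v∈G
      ... | inj₂ refl = ≢ℓ (B⊆S v∈B) refl
      end∉G′ : ∀ v → EndOf A R v → v ∉ G ∪ ⁅ ℓ ⁆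
      end∉G′ v end v∈ with x∈p∪⁅y⁆⁻ v∈
      ... | inj₁ v∈G = end∉G v end v∈G
      ... | inj₂ refl = ≢ℓ (end∈S end) refl
      G′⊆S : G ∪ ⁅ ℓ ⁆ ⊆ S
      G′⊆S v∈ with x∈p∪⁅y⁆⁻ v∈
      ... | inj₁ v∈G = ⊆S (G⊆S v∈G)
      ... | inj₂ refl = ℓ∈S
      G-neighbour∈B′ : ∀ {e x y} → Incident A x e → Incident A y e → x ≢ y → x ∈ S → y ∈ S →
                       x ∈ G ∪ ⁅ ℓ ⁆ → y ∈ B
      G-neighbour∈B′ {e} {y = y} x∈e y∈e x≢y x∈S y∈S x∈G′ with x∈p∪⁅y⁆⁻ x∈G′ | y ≟ ℓ
      ... | inj₂ refl | _ = ⊥-elim (ℓ-isolated e (inside-edge x∈e y∈e x≢y x∈S y∈S) x∈e)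
      ... | inj₁ _ | yes refl = ⊥-elim (ℓ-isolated e (inside-edge x∈e y∈e x≢y x∈S y∈S) y∈e)
      ... | inj₁ x∈G | no y≢ℓ = G-neighbour∈B x∈e y∈e x≢y (G⊆S x∈G) (x∈p∧x≢y⇒x∈p-y y∈S y≢ℓ) x∈G

  module LeafStep {S ℓ e} (ℓ∈S : ℓ ∈ S) (e-in : Leaves.Inside A acyclic S e) (ℓ∈e : Incident A ℓ e)
                  (only-e : ∀ f → Leaves.Inside A acyclic S f → Incident A ℓ f → f ≡ e) where
    open Leaves A acyclic S using (inside-edge; other∈W)

    p : Fin n
    p = other ℓ∈e

    p∈e : Incident A p e
    p∈e = other-incident ℓ∈e

    ℓ≢p : ℓ ≢ p
    ℓ≢p = ≢other ℓ∈e

    S′ : Subset n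
    S′ = S - ℓ - p

    S′⊂S : S′ ⊂ S
    S′⊂S = p-x-y⊂p p ℓ∈S

    ⊆S : ∀ {v} → v ∈ S′ → v ∈ S
    ⊆S v∈ = proj₁ (x∈p-y-z⁻ v∈)

    ≢ℓ : ∀ {v} → v ∈ S′ → v ≢ ℓ
    ≢ℓ v∈ = proj₁ (proj₂ (x∈p-y-z⁻ v∈))

    ≢p : ∀ {v} → v ∈ S′ → v ≢ p
    ≢p v∈ = proj₂ (proj₂ (x∈p-y-z⁻ v∈))

    e-end∉S′ : ∀ {v} → Incident A v e → v ∉ S′
    e-end∉S′ v∈e v∈S′ with incident-cases ℓ∈e v∈e
    ... | inj₁ refl = ≢ℓ v∈S′ refl
    ... | inj₂ refl = ≢p v∈S′ refl

    trichotomy : ∀ {v} → v ∈ S → v ≡ ℓ ⊎ v ≡ p ⊎ v ∈ S′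
    trichotomy = x∈p⇒x≡y⊎x≡z⊎x∈p-y-z ℓ p

    neighbour-of-ℓ : ∀ {f y} → Incident A ℓ f → Incident A y f → y ≢ ℓ → y ∈ S → y ≡ p
    neighbour-of-ℓ ℓ∈f y∈f y≢ℓ y∈S with only-e _ (inside-edge ℓ∈f y∈f (≢-sym y≢ℓ) ℓ∈S y∈S) ℓ∈f
    ... | refl = ≡-other ℓ∈e y∈f y≢ℓ

    add-B : ∀ {B R G f} → TricoloringOn S′ B R G → JoinsToG A G p f → TricoloringOn S (B ∪ ⁅ p ⁆) R (G ∪ ⁅ ℓ ⁆)
    add-B {B} {R} {G} {f} c joins-f = record
      { partition       = partition′
      ; B∌end           = B∌end′
      ; B∌G             = B∌G′
      ; end∉G           = end∉G′
      ; B⊆S             = B′⊆S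
      ; end∈S           = λ end → ⊆S (end∈S end)
      ; G⊆S             = G′⊆S
      ; R-matching      = R-matching
      ; G-neighbour∈B   = G-neighbour∈B′
      ; B-joins-G-twice = B-joins-G-twice′
      }
      where
      open TricoloringOn c
      partition′ : ∀ v → v ∈ S → v ∈ B ∪ ⁅ p ⁆ ⊎ EndOf A R v ⊎ v ∈ G ∪ ⁅ ℓ ⁆
      partition′ v v∈S with trichotomy v∈S
      ... | inj₁ refl = inj₂ (inj₂ y∈p∪⁅y⁆)
      ... | inj₂ (inj₁ refl) = inj₁ y∈p∪⁅y⁆
      ... | inj₂ (inj₂ v∈S′) with partition v v∈S′
      ...   | inj₁ v∈B = inj₁ (x∈p⇒x∈p∪⁅y⁆ v∈B)
      ...   | inj₂ (inj₁ end) = inj₂ (inj₁ end)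
      ...   | inj₂ (inj₂ v∈G) = inj₂ (inj₂ (x∈p⇒x∈p∪⁅y⁆ v∈G))
      B∌end′ : ∀ v → v ∈ B ∪ ⁅ p ⁆ → ¬ EndOf A R v
      B∌end′ v v∈ end with x∈p∪⁅y⁆⁻ v∈
      ... | inj₁ v∈B = B∌end v v∈B end
      ... | inj₂ refl = ≢p (end∈S end) refl
      B∌G′ : ∀ v → v ∈ B ∪ ⁅ p ⁆ → v ∉ G ∪ ⁅ ℓ ⁆
      B∌G′ v v∈B′ v∈G′ with x∈p∪⁅y⁆⁻ v∈B′ | x∈p∪⁅y⁆⁻ v∈G′
      ... | inj₁ v∈B | inj₁ v∈G = B∌G v v∈B v∈G
      ... | inj₁ v∈B | inj₂ refl = ≢ℓ (B⊆S v∈B) refl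
      ... | inj₂ refl | inj₁ v∈G = ≢p (G⊆S v∈G) refl
      ... | inj₂ refl | inj₂ p≡ℓ = ℓ≢p (sym p≡ℓ)
      end∉G′ : ∀ v → EndOf A R v → v ∉ G ∪ ⁅ ℓ ⁆
      end∉G′ v end v∈ with x∈p∪⁅y⁆⁻ v∈
      ... | inj₁ v∈G = end∉G v end v∈G
      ... | inj₂ refl = ≢ℓ (end∈S end) refl
      B′⊆S : B ∪ ⁅ p ⁆ ⊆ S
      B′⊆S v∈ with x∈p∪⁅y⁆⁻ v∈
      ... | inj₁ v∈B = ⊆S (B⊆S v∈B)
      ... | inj₂ refl = other∈W ℓ∈e e-in
      G′⊆S : G ∪ ⁅ ℓ ⁆ ⊆ S
      G′⊆S v∈ with x∈p∪⁅y⁆⁻ v∈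
      ... | inj₁ v∈G = ⊆S (G⊆S v∈G)
      ... | inj₂ refl = ℓ∈S
      G-neighbour∈B′ : ∀ {e x y} → Incident A x e → Incident A y e → x ≢ y → x ∈ S → y ∈ S →
                       x ∈ G ∪ ⁅ ℓ ⁆ → y ∈ B ∪ ⁅ p ⁆
      G-neighbour∈B′ x∈e y∈e x≢y x∈S y∈S x∈G′ with x∈p∪⁅y⁆⁻ x∈G′
      ... | inj₂ refl = subst (_∈ B ∪ ⁅ p ⁆) (sym (neighbour-of-ℓ x∈e y∈e (≢-sym x≢y) y∈S)) y∈p∪⁅y⁆
      ... | inj₁ x∈G with trichotomy y∈S
      ...   | inj₁ refl = ⊥-elim (≢p (G⊆S x∈G) (neighbour-of-ℓ y∈e x∈e x≢y x∈S))
      ...   | inj₂ (inj₁ refl) = y∈p∪⁅y⁆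
      ...   | inj₂ (inj₂ y∈S′) = x∈p⇒x∈p∪⁅y⁆ (G-neighbour∈B x∈e y∈e x≢y (G⊆S x∈G) y∈S′ x∈G)
      B-joins-G-twice′ : ∀ v → v ∈ B ∪ ⁅ p ⁆ → JoinsTwice (G ∪ ⁅ ℓ ⁆) v
      B-joins-G-twice′ v v∈ with x∈p∪⁅y⁆⁻ v∈
      ... | inj₁ v∈B = JoinsTwice-mono x∈p⇒x∈p∪⁅y⁆ (B-joins-G-twice v v∈B)
      ... | inj₂ refl = e , f , e≢f , joins-other p∈e (subst (_∈ G ∪ ⁅ ℓ ⁆) ℓ≡ y∈p∪⁅y⁆) ,
                        joins-mono x∈p⇒x∈p∪⁅y⁆ joins-f
        where
        ℓ≡ : ℓ ≡ other p∈e
        ℓ≡ = ≡-other p∈e ℓ∈e ℓ≢p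
        e≢f : e ≢ f
        e≢f refl with joins⁻ joins-f
        ... | p∈e′ , o∈G = ≢ℓ (G⊆S (subst (_∈ G) (sym (≡-other p∈e′ ℓ∈e ℓ≢p)) o∈G)) refl

    add-R : ∀ {B R G} → TricoloringOn S′ B R G → (∀ f → ¬ JoinsToG A G p f) → TricoloringOn S B (R ∪ ⁅ e ⁆) G
    add-R {B} {R} {G} c p-joins-no-G = record
      { partition       = partition′
      ; B∌end           = λ v v∈B end → [ B∌end v v∈B , (λ v∈e → e-end∉S′ v∈e (B⊆S v∈B)) ]′ (end⁻ end)
      ; B∌G             = B∌G
      ; end∉G           = λ v end v∈G → [ (λ end → end∉G v end v∈G) , (λ v∈e → e-end∉S′ v∈e (G⊆S v∈G)) ]′ (end⁻ end)
      ; B⊆S             = λ v∈B → ⊆S (B⊆S v∈B)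
      ; end∈S           = end∈S′
      ; G⊆S             = λ v∈G → ⊆S (G⊆S v∈G)
      ; R-matching      = R-matching′
      ; G-neighbour∈B   = G-neighbour∈B′
      ; B-joins-G-twice = B-joins-G-twice
      }
      where
      open TricoloringOn c
      end⁻ : ∀ {v} → EndOf A (R ∪ ⁅ e ⁆) v → EndOf A R v ⊎ Incident A v e
      end⁻ (f , f∈ , v∈f) with x∈p∪⁅y⁆⁻ f∈
      ... | inj₁ f∈R = inj₁ (f , f∈R , v∈f)
      ... | inj₂ refl = inj₂ v∈f
      partition′ : ∀ v → v ∈ S → v ∈ B ⊎ EndOf A (R ∪ ⁅ e ⁆) v ⊎ v ∈ G
      partition′ v v∈S with trichotomy v∈S
      ... | inj₁ refl = inj₂ (inj₁ (e , y∈p∪⁅y⁆ , ℓ∈e))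
      ... | inj₂ (inj₁ refl) = inj₂ (inj₁ (e , y∈p∪⁅y⁆ , p∈e))
      ... | inj₂ (inj₂ v∈S′) with partition v v∈S′
      ...   | inj₁ v∈B = inj₁ v∈B
      ...   | inj₂ (inj₁ (f , f∈R , v∈f)) = inj₂ (inj₁ (f , x∈p⇒x∈p∪⁅y⁆ f∈R , v∈f))
      ...   | inj₂ (inj₂ v∈G) = inj₂ (inj₂ v∈G)
      end∈S′ : ∀ {v} → EndOf A (R ∪ ⁅ e ⁆) v → v ∈ S
      end∈S′ end with end⁻ end
      ... | inj₁ end = ⊆S (end∈S end)
      ... | inj₂ v∈e with incident-cases ℓ∈e v∈e
      ...   | inj₁ refl = ℓ∈S
      ...   | inj₂ refl = other∈W ℓ∈e e-in
      R-matching′ : PairwiseNonAdjacent A (R ∪ ⁅ e ⁆)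
      R-matching′ f g f∈ g∈ f≢g v v∈f v∈g with x∈p∪⁅y⁆⁻ f∈ | x∈p∪⁅y⁆⁻ g∈
      ... | inj₁ f∈R | inj₁ g∈R = R-matching f g f∈R g∈R f≢g v v∈f v∈g
      ... | inj₁ f∈R | inj₂ refl = e-end∉S′ v∈g (end∈S (f , f∈R , v∈f))
      ... | inj₂ refl | inj₁ g∈R = e-end∉S′ v∈f (end∈S (g , g∈R , v∈g))
      ... | inj₂ refl | inj₂ refl = f≢g refl
      G-neighbour∈B′ : ∀ {f x y} → Incident A x f → Incident A y f → x ≢ y → x ∈ S → y ∈ S → x ∈ G → y ∈ B
      G-neighbour∈B′ x∈f y∈f x≢y x∈S y∈S x∈G with trichotomy y∈S
      ... | inj₁ refl = ⊥-elim (≢p (G⊆S x∈G) (neighbour-of-ℓ y∈f x∈f x≢y x∈S))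
      ... | inj₂ (inj₁ refl) = ⊥-elim (p-joins-no-G _ (joins-other y∈f (subst (_∈ G) (≡-other y∈f x∈f x≢y) x∈G)))
      ... | inj₂ (inj₂ y∈S′) = G-neighbour∈B x∈f y∈f x≢y (G⊆S x∈G) y∈S′ x∈G

    extend : (∃[ B ] ∃[ R ] ∃[ G ] TricoloringOn S′ B R G) → ∃[ B ] ∃[ R ] ∃[ G ] TricoloringOn S B R G
    extend (B , R , G , c) with any? (JoinsToG? G p)
    ... | yes (f , p-joins-G) = B ∪ ⁅ p ⁆ , R , G ∪ ⁅ ℓ ⁆ , add-B c p-joins-G
    ... | no p-joins-no-G = B , R ∪ ⁅ e ⁆ , G , add-R c (λ f joins → p-joins-no-G (f , joins))

  tricoloring-on : ∀ {S} → Acc _⊂_ S → ∃[ B ] ∃[ R ] ∃[ G ] TricoloringOn S B R G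
  tricoloring-on {S} (acc smaller) with nonempty? S
  ... | no S-empty = ∅ , ∅ , ∅ , tricoloring-on-∅ (λ v v∈S → S-empty (v , v∈S))
  ... | yes (u , u∈S) with Leaves.leaf-or-isolated A acyclic S u∈S
  ...   | inj₁ u-isolated =
          let (B , R , G , c) = tricoloring-on (smaller (x∈p⇒p-x⊂p u∈S))
          in B , R , G ∪ ⁅ u ⁆ , add-isolated u∈S u-isolated c
  ...   | inj₂ (ℓ , ℓ∈S , _ , e , e-in , ℓ∈e , only-e) =
          LeafStep.extend ℓ∈S e-in ℓ∈e only-e (tricoloring-on (smaller (LeafStep.S′⊂S ℓ∈S e-in ℓ∈e only-e)))

  tricoloring-with-iii : Σ (Tricol A) λ T → IsTricoloring A T × Prop-iii A T
  tricoloring-with-iii with tricoloring-on (⊂-wellFounded full)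
  ... | B , R , G , c =
        (B , R , G) ,
        ((λ v → partition v ∈⊤) , B∌end , B∌G , end∉G) ,
        R-matching ,
        (λ e → G-neighbour∈B (inj₁ refl) (inj₂ refl) (loopless e) ∈⊤ ∈⊤ ,
               G-neighbour∈B (inj₂ refl) (inj₁ refl) (≢-sym (loopless e)) ∈⊤ ∈⊤) ,
        B-joins-G-twice
    where open TricoloringOn c

-- Matchings against vertex covers

module Duality {n m : ℕ} (A : Graph n m) where
  open Graph A
  open Edges A

  shared-vertex⇒≡ : ∀ {M e f v} → Matching A M → e ∈ M → f ∈ M → Incident A v e → Incident A v f → e ≡ f
  shared-vertex⇒≡ {e = e} {f} {v} matching e∈M f∈M v∈e v∈f with e ≟ f
  ... | yes e≡f = e≡f
  ... | no e≢f = ⊥-elim (matching e f e∈M f∈M e≢f v v∈e v∈f)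

  covered-end : ∀ {C} → VertexCover A C → ∀ e → ∃[ v ] v ∈ C × Incident A v e
  covered-end cover e with cover e
  ... | inj₁ e₁∈C = end₁ A e , e₁∈C , inj₁ refl
  ... | inj₂ e₂∈C = end₂ A e , e₂∈C , inj₂ refl

  matching↪ : ∀ {M C} → Matching A M → (∀ {e} → e ∈ M → ∃[ v ] v ∈ C × Incident A v e) → M ↪ C
  matching↪ matching end = record
    { image     = λ e∈M → proj₁ (end e∈M)
    ; image∈    = λ e∈M → proj₁ (proj₂ (end e∈M))
    ; injective = λ e∈M f∈M eq →
        shared-vertex⇒≡ matching e∈M f∈M (proj₂ (proj₂ (end e∈M)))
          (subst (λ v → Incident A v _) (sym eq) (proj₂ (proj₂ (end f∈M))))
    }

  matching≤cover : ∀ {M C} → Matching A M → VertexCover A C → ∣ M ∣ ≤ ∣ C ∣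
  matching≤cover matching cover = ↪⇒∣≤∣ (matching↪ matching (λ {e} _ → covered-end cover e))

  saturated⇒∣C∣≤∣M∣ : ∀ {M C} → (∀ {v} → v ∈ C → ∃[ e ] e ∈ M × Incident A v e) →
                      (∀ {e} → e ∈ M → ¬ (end₁ A e ∈ C × end₂ A e ∈ C)) → ∣ C ∣ ≤ ∣ M ∣
  saturated⇒∣C∣≤∣M∣ {M} {C} saturated one-end = ↪⇒∣≤∣ (record
    { image     = λ v∈C → proj₁ (saturated v∈C)
    ; image∈    = λ v∈C → proj₁ (proj₂ (saturated v∈C))
    ; injective = injective
    })
    where
    injective : ∀ {v w} (v∈C : v ∈ C) (w∈C : w ∈ C) → proj₁ (saturated v∈C) ≡ proj₁ (saturated w∈C) → v ≡ w
    injective {v} {w} v∈C w∈C eq with v ≟ w | saturated v∈C | saturated w∈C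
    ... | yes v≡w | _ | _ = v≡w
    ... | no v≢w | e , e∈M , v∈e | _ , _ , w∈f =
          ⊥-elim (one-end e∈M (both-ends v∈e (subst (Incident A w) (sym eq) w∈f) v≢w v∈C w∈C))

  module _ {M C} (matching : Matching A M) (cover : VertexCover A C) (C≤M : ∣ C ∣ ≤ ∣ M ∣) where

    unmatched∉tight-cover : ∀ {c} → (∀ e → e ∈ M → ¬ Incident A c e) → c ∉ C
    unmatched∉tight-cover {c} unmatched c∈C =
      ≤⇒≯ C≤M (↪-missing⇒∣<∣ (matching↪ matching (λ {e} _ → covered-end cover e)) c∈C misses)
      where
      misses : ∀ {e} → e ∈ M → proj₁ (covered-end cover e) ≢ c
      misses {e} e∈M refl = unmatched e e∈M (proj₂ (proj₂ (covered-end cover e)))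

    -- Covering e by end₁ and every other edge of M by any of its ends misses end₂ e.
    tight-cover-one-end : ∀ {e} → e ∈ M → ¬ (end₁ A e ∈ C × end₂ A e ∈ C)
    tight-cover-one-end {e} e∈M (e₁∈C , e₂∈C) =
      ≤⇒≯ C≤M (↪-missing⇒∣<∣ (matching↪ matching (λ {f} _ → choose f)) e₂∈C misses)
      where
      choose : ∀ f → ∃[ v ] v ∈ C × Incident A v f
      choose f with f ≟ e
      ... | yes refl = end₁ A e , e₁∈C , inj₁ refl
      ... | no _ = covered-end cover f
      misses : ∀ {f} → f ∈ M → proj₁ (choose f) ≢ end₂ A e
      misses {f} f∈M with f ≟ e
      ... | yes refl = loopless e
      ... | no f≢e = λ eq → f≢e (shared-vertex⇒≡ matching f∈M e∈M
                       (subst (λ v → Incident A v f) eq (proj₂ (proj₂ (covered-end cover f)))) (inj₂ refl))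

-- Tricolorings with property (iii) satisfy (i) and (ii)

module FromProp-iii {n m : ℕ} (A : Graph n m) (acyclic : Acyclic A)
  {B : Subset n} {R : Subset m} {G : Subset n}
  (tricoloring : IsTricoloring A (B , R , G)) (iii : Prop-iii A (B , R , G)) where
  open Graph A
  open Edges A
  open Duality A

  Red : Fin n → Set
  Red = EndOf A R

  colour : ∀ v → v ∈ B ⊎ Red v ⊎ v ∈ G
  colour = proj₁ tricoloring

  B∌red : ∀ {v} → v ∈ B → ¬ Red v
  B∌red = proj₁ (proj₂ tricoloring) _

  B∌G : ∀ {v} → v ∈ B → v ∉ G
  B∌G = proj₁ (proj₂ (proj₂ tricoloring)) _

  red∉G : ∀ {v} → Red v → v ∉ G
  red∉G = proj₂ (proj₂ (proj₂ tricoloring)) _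

  R-matching : Matching A R
  R-matching = proj₁ iii

  G-neighbour∈B : ∀ {e x y} → Incident A x e → Incident A y e → x ≢ y → x ∈ G → y ∈ B
  G-neighbour∈B {e} (inj₁ refl) (inj₂ refl) _ = proj₁ (proj₁ (proj₂ iii) e)
  G-neighbour∈B {e} (inj₂ refl) (inj₁ refl) _ = proj₂ (proj₁ (proj₂ iii) e)
  G-neighbour∈B (inj₁ refl) (inj₁ refl) x≢y = ⊥-elim (x≢y refl)
  G-neighbour∈B (inj₂ refl) (inj₂ refl) x≢y = ⊥-elim (x≢y refl)

  G-end-unique : ∀ {e g g′} → Incident A g e → Incident A g′ e → g ∈ G → g′ ∈ G → g ≡ g′
  G-end-unique {g = g} {g′} g∈e g′∈e g∈G g′∈G with g ≟ g′
  ... | yes g≡g′ = g≡g′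
  ... | no g≢g′ = ⊥-elim (B∌G (G-neighbour∈B g∈e g′∈e g≢g′ g∈G) g′∈G)

  B-joins-G-twice : ∀ v → v ∈ B → JoinsTwice G v
  B-joins-G-twice = proj₂ (proj₂ iii)

  record Saturating (g₀ : Fin n) (S H : Subset n) (N : Subset m) : Set where
    field
      matching  : Matching A N
      edge-ends : ∀ {e} → e ∈ N → ∃[ b ] ∃[ g ] Incident A b e × Incident A g e × b ∈ S × g ∈ H × g ≢ g₀
      saturates : ∀ {b} → b ∈ S → ∃[ e ] e ∈ N × Incident A b e

  module Saturation (g₀ : Fin n) {S H : Subset n} (S⊆B : S ⊆ B) (H⊆G : H ⊆ G)
                    (joins-twice : ∀ v → v ∈ S → JoinsTwice H v) where
    open Leaves A acyclic (S ∪ H)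

    joins⇒inside : ∀ {v e} → v ∈ S → JoinsToG A H v e → Incident A v e × Inside e
    joins⇒inside v∈S joins with joins⁻ joins
    ... | v∈e , o∈H = v∈e , inside-edge v∈e (other-incident v∈e) (≢other v∈e)
                                        (x∈p∪q⁺ (inj₁ v∈S)) (x∈p∪q⁺ (inj₂ o∈H))

    not-isolated : ∀ {v} → v ∈ S → ¬ Isolated v
    not-isolated {v} v∈S isolated with joins-twice v v∈S
    ... | e , _ , _ , joins , _ = let (v∈e , e-in) = joins⇒inside v∈S joins in isolated e e-in v∈e

    module Step {ℓ e} (ℓ∈W : ℓ ∈ S ∪ H) (ℓ≢g₀ : ℓ ≢ g₀) (e-in : Inside e) (ℓ∈e : Incident A ℓ e)
                (only-e : ∀ f → Inside f → Incident A ℓ f → f ≡ e) where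

      ℓ∉S : ℓ ∉ S
      ℓ∉S ℓ∈S with joins-twice ℓ ℓ∈S
      ... | f₁ , f₂ , f₁≢f₂ , joins₁ , joins₂ =
            let (ℓ∈f₁ , f₁-in) = joins⇒inside ℓ∈S joins₁ ; (ℓ∈f₂ , f₂-in) = joins⇒inside ℓ∈S joins₂
            in f₁≢f₂ (trans (only-e f₁ f₁-in ℓ∈f₁) (sym (only-e f₂ f₂-in ℓ∈f₂)))

      ℓ∈H : ℓ ∈ H
      ℓ∈H with x∈p∪q⁻ S H ℓ∈W
      ... | inj₁ ℓ∈S = ⊥-elim (ℓ∉S ℓ∈S)
      ... | inj₂ ℓ∈H = ℓ∈H

      b′ : Fin n
      b′ = other ℓ∈e

      b′∈B : b′ ∈ B
      b′∈B = G-neighbour∈B ℓ∈e (other-incident ℓ∈e) (≢other ℓ∈e) (H⊆G ℓ∈H)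

      b′∈S : b′ ∈ S
      b′∈S with x∈p∪q⁻ S H (other∈W ℓ∈e e-in)
      ... | inj₁ b′∈S = b′∈S
      ... | inj₂ b′∈H = ⊥-elim (B∌G b′∈B (H⊆G b′∈H))

      S′⊂S : S - b′ ⊂ S
      S′⊂S = x∈p⇒p-x⊂p b′∈S

      S′⊆B : S - b′ ⊆ B
      S′⊆B v∈ = S⊆B (proj₁ (x∈p-y⁻ v∈))

      H′⊆G : H - ℓ ⊆ G
      H′⊆G v∈ = H⊆G (proj₁ (x∈p-y⁻ v∈))

      joins-twice′ : ∀ v → v ∈ S - b′ → JoinsTwice (H - ℓ) v
      joins-twice′ v v∈S′ with x∈p-y⁻ v∈S′ | joins-twice v (proj₁ (x∈p-y⁻ v∈S′))
      ... | v∈S , v≢b′ | f₁ , f₂ , f₁≢f₂ , joins₁ , joins₂ = f₁ , f₂ , f₁≢f₂ , avoid-ℓ joins₁ , avoid-ℓ joins₂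
        where
        avoid-ℓ : ∀ {f} → JoinsToG A H v f → JoinsToG A (H - ℓ) v f
        avoid-ℓ {f} joins with joins⁻ joins
        ... | v∈f , o∈H = joins-other v∈f (x∈p∧x≢y⇒x∈p-y o∈H o≢ℓ)
          where
          o≢ℓ : other v∈f ≢ ℓ
          o≢ℓ o≡ℓ with only-e f (proj₂ (joins⇒inside v∈S joins)) (subst (λ z → Incident A z f) o≡ℓ (other-incident v∈f))
          ... | refl = v≢b′ (≡-other ℓ∈e v∈f (λ { refl → ℓ∉S v∈S }))

      extend : (∃[ N ] Saturating g₀ (S - b′) (H - ℓ) N) → ∃[ N ] Saturating g₀ S H N
      extend (N , sat) = N ∪ ⁅ e ⁆ , record
        { matching  = matching′
        ; edge-ends = edge-ends′
        ; saturates = saturates′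
        }
        where
        open Saturating sat
        N-end : ∀ {f v} → f ∈ N → Incident A v f → v ∈ S - b′ ⊎ v ∈ H - ℓ
        N-end f∈N v∈f with edge-ends f∈N
        ... | x , y , x∈f , y∈f , x∈S′ , y∈H′ , _ with incident-cases x∈f v∈f | incident-cases x∈f y∈f
        ...   | inj₁ refl | _ = inj₁ x∈S′
        ...   | inj₂ _ | inj₁ refl = ⊥-elim (B∌G (S′⊆B x∈S′) (H′⊆G y∈H′))
        ...   | inj₂ v≡o | inj₂ y≡o = inj₂ (subst (_∈ H - ℓ) (trans y≡o (sym v≡o)) y∈H′)
        e-end∉ : ∀ {v} → Incident A v e → ¬ (v ∈ S - b′ ⊎ v ∈ H - ℓ)
        e-end∉ v∈e v∈ with incident-cases ℓ∈e v∈e | v∈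
        ... | inj₁ refl | inj₁ ℓ∈S′ = ℓ∉S (proj₁ (x∈p-y⁻ ℓ∈S′))
        ... | inj₁ refl | inj₂ ℓ∈H′ = x∉p-x H ℓ ℓ∈H′
        ... | inj₂ refl | inj₁ b′∈S′ = x∉p-x S b′ b′∈S′
        ... | inj₂ refl | inj₂ b′∈H′ = B∌G b′∈B (H′⊆G b′∈H′)
        matching′ : Matching A (N ∪ ⁅ e ⁆)
        matching′ f₁ f₂ f₁∈ f₂∈ f₁≢f₂ v v∈f₁ v∈f₂ with x∈p∪⁅y⁆⁻ f₁∈ | x∈p∪⁅y⁆⁻ f₂∈
        ... | inj₁ f₁∈N | inj₁ f₂∈N = matching f₁ f₂ f₁∈N f₂∈N f₁≢f₂ v v∈f₁ v∈f₂
        ... | inj₁ f₁∈N | inj₂ refl = e-end∉ v∈f₂ (N-end f₁∈N v∈f₁)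
        ... | inj₂ refl | inj₁ f₂∈N = e-end∉ v∈f₁ (N-end f₂∈N v∈f₂)
        ... | inj₂ refl | inj₂ refl = f₁≢f₂ refl
        edge-ends′ : ∀ {f} → f ∈ N ∪ ⁅ e ⁆ →
                     ∃[ b ] ∃[ g ] Incident A b f × Incident A g f × b ∈ S × g ∈ H × g ≢ g₀
        edge-ends′ f∈ with x∈p∪⁅y⁆⁻ f∈
        ... | inj₁ f∈N = let (b , g , b∈f , g∈f , b∈S′ , g∈H′ , g≢g₀) = edge-ends f∈N
                         in b , g , b∈f , g∈f , proj₁ (x∈p-y⁻ b∈S′) , proj₁ (x∈p-y⁻ g∈H′) , g≢g₀
        ... | inj₂ refl = b′ , ℓ , other-incident ℓ∈e , ℓ∈e , b′∈S , ℓ∈H , ℓ≢g₀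
        saturates′ : ∀ {b} → b ∈ S → ∃[ f ] f ∈ N ∪ ⁅ e ⁆ × Incident A b f
        saturates′ {b} b∈S with b ≟ b′
        ... | yes refl = e , y∈p∪⁅y⁆ , other-incident ℓ∈e
        ... | no b≢b′ = let (f , f∈N , b∈f) = saturates (x∈p∧x≢y⇒x∈p-y b∈S b≢b′) in f , x∈p⇒x∈p∪⁅y⁆ f∈N , b∈f

  saturating : ∀ g₀ {S} → Acc _⊂_ S → ∀ {H} → S ⊆ B → H ⊆ G → (∀ v → v ∈ S → JoinsTwice H v) →
               ∃[ N ] Saturating g₀ S H N
  saturating g₀ {S} (acc smaller) {H} S⊆B H⊆G joins-twice with nonempty? S
  ... | no S-empty = ∅ , record
        { matching  = λ _ _ e∈∅ → ⊥-elim (∉⊥ e∈∅)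
        ; edge-ends = λ e∈∅ → ⊥-elim (∉⊥ e∈∅)
        ; saturates = λ {b} b∈S → ⊥-elim (S-empty (b , b∈S))
        }
  ... | yes (b , b∈S)
    with Leaves.leaf-avoiding A acyclic (S ∪ H) (x∈p∪q⁺ (inj₁ b∈S)) (Saturation.not-isolated g₀ S⊆B H⊆G joins-twice b∈S) g₀
  ...   | ℓ , ℓ∈W , ℓ≢g₀ , e , e-in , ℓ∈e , only-e =
          extend (saturating g₀ (smaller S′⊂S) S′⊆B H′⊆G joins-twice′)
    where open Saturation.Step g₀ S⊆B H⊆G joins-twice ℓ∈W ℓ≢g₀ e-in ℓ∈e only-e

  reds : Subset n
  reds = ∁ (B ∪ G)

  red⇒∈reds : ∀ {v} → Red v → v ∈ reds
  red⇒∈reds red = x∉p⇒x∈∁p λ v∈B∪G → [ (λ v∈B → B∌red v∈B red) , red∉G red ]′ (x∈p∪q⁻ B G v∈B∪G)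

  ∈reds⇒red : ∀ {v} → v ∈ reds → Red v
  ∈reds⇒red {v} v∈reds with colour v
  ... | inj₁ v∈B = ⊥-elim (x∈∁p⇒x∉p v∈reds (x∈p∪q⁺ (inj₁ v∈B)))
  ... | inj₂ (inj₁ red) = red
  ... | inj₂ (inj₂ v∈G) = ⊥-elim (x∈∁p⇒x∉p v∈reds (x∈p∪q⁺ (inj₂ v∈G)))

  R-closed : Subset n → Set
  R-closed P = ∀ {r v w} → r ∈ R → Incident A v r → Incident A w r → v ∈ P → w ∈ P

  Compatible : Fin n → Fin n → Set
  Compatible q₁ q₂ = q₁ ≡ q₂ ⊎ ∃[ e ] e ∉ R × Incident A q₁ e × Incident A q₂ e

  self-compatible : ∀ q → Compatible q q
  self-compatible q = inj₁ refl

  -- For P the set of red vertices, B ∪ K is a minimum vertex cover forced to contain q₁ and q₂.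
  record Transversal (P : Subset n) (q₁ q₂ : Fin n) (K : Subset n) : Set where
    field
      K⊆P       : K ⊆ P
      R-one-end : ∀ {r v w} → r ∈ R → Incident A v r → Incident A w r → v ≢ w → v ∈ K → w ∉ K
      covers    : ∀ {e v w} → Incident A v e → Incident A w e → v ≢ w → v ∈ P → w ∈ P → v ∈ K ⊎ w ∈ K
      q₁∈K      : q₁ ∈ P → q₁ ∈ K
      q₂∈K      : q₂ ∈ P → q₂ ∈ K

  module Transversals {q₁ q₂} (compatible : Compatible q₁ q₂) where

    module Pick {P} (P-red : ∀ {v} → v ∈ P → Red v) (P-closed : R-closed P) where
      open Leaves A acyclic P

      RLeaf : Fin n → Set
      RLeaf ℓ = ∃[ r ] r ∈ R × Incident A ℓ r × (∀ f → Inside f → Incident A ℓ f → f ≡ r)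

      R-edge-inside : ∀ {r v} → r ∈ R → Incident A v r → v ∈ P → Inside r
      R-edge-inside r∈R v∈r v∈P =
        inside-edge v∈r (other-incident v∈r) (≢other v∈r) v∈P
                    (P-closed r∈R v∈r (other-incident v∈r) v∈P)

      not-isolated : ∀ {v} → v ∈ P → ¬ Isolated v
      not-isolated v∈P isolated = let (r , r∈R , v∈r) = P-red v∈P in isolated r (R-edge-inside r∈R v∈r v∈P) v∈r

      leaf⇒RLeaf : ∀ {ℓ} → ℓ ∈ P → Leaf ℓ → RLeaf ℓ
      leaf⇒RLeaf ℓ∈P (e , e-in , ℓ∈e , only-e) with P-red ℓ∈P
      ... | r , r∈R , ℓ∈r = r , r∈R , ℓ∈r , λ f f-in ℓ∈f →
            trans (only-e f f-in ℓ∈f) (sym (only-e r (R-edge-inside r∈R ℓ∈r ℓ∈P) ℓ∈r))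

      -- When q₁ ∈ P, a leaf at q₂ would have the edge to q₁ outside R as a second edge.
      RLeaf-avoiding : ∀ {u} → u ∈ P → ∃[ ℓ ] ℓ ∈ P × ℓ ≢ q₁ × ℓ ≢ q₂ × RLeaf ℓ
      RLeaf-avoiding u∈P with q₁ ∈? P
      ... | no q₁∉P =
            let (ℓ , ℓ∈P , ℓ≢q₂ , leaf) = leaf-avoiding u∈P (not-isolated u∈P) q₂
            in ℓ , ℓ∈P , (λ { refl → q₁∉P ℓ∈P }) , ℓ≢q₂ , leaf⇒RLeaf ℓ∈P leaf
      ... | yes q₁∈P =
            let (ℓ , ℓ∈P , ℓ≢q₁ , leaf) = leaf-avoiding u∈P (not-isolated u∈P) q₁
            in ℓ , ℓ∈P , ℓ≢q₁ , ≢q₂ compatible ℓ∈P ℓ≢q₁ (leaf⇒RLeaf ℓ∈P leaf) , leaf⇒RLeaf ℓ∈P leaf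
        where
        ≢q₂ : ∀ {ℓ} → Compatible q₁ q₂ → ℓ ∈ P → ℓ ≢ q₁ → RLeaf ℓ → ℓ ≢ q₂
        ≢q₂ (inj₁ q₁≡q₂) _ ℓ≢q₁ _ ℓ≡q₂ = ℓ≢q₁ (trans ℓ≡q₂ (sym q₁≡q₂))
        ≢q₂ (inj₂ (e₀ , e₀∉R , q₁∈e₀ , ℓ∈e₀)) ℓ∈P ℓ≢q₁ (r , r∈R , _ , only-r) refl =
              e₀∉R (subst (_∈ R) (sym (only-r e₀ (inside-edge q₁∈e₀ ℓ∈e₀ (≢-sym ℓ≢q₁) q₁∈P ℓ∈P) ℓ∈e₀)) r∈R)

    module Step {P ℓ r} (P-red : ∀ {v} → v ∈ P → Red v) (P-closed : R-closed P)
                (ℓ∈P : ℓ ∈ P) (ℓ≢q₁ : ℓ ≢ q₁) (ℓ≢q₂ : ℓ ≢ q₂) (r∈R : r ∈ R) (ℓ∈r : Incident A ℓ r)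
                (only-r : ∀ f → Leaves.Inside A acyclic P f → Incident A ℓ f → f ≡ r) where
      open Leaves A acyclic P using (inside-edge)

      p : Fin n
      p = other ℓ∈r

      p∈r : Incident A p r
      p∈r = other-incident ℓ∈r

      p∈P : p ∈ P
      p∈P = P-closed r∈R ℓ∈r p∈r ℓ∈P

      P′ : Subset n
      P′ = P - ℓ - p

      P′⊂P : P′ ⊂ P
      P′⊂P = p-x-y⊂p p ℓ∈P

      ⊆P : ∀ {v} → v ∈ P′ → v ∈ P
      ⊆P v∈ = proj₁ (x∈p-y-z⁻ v∈)

      r-end∉P′ : ∀ {v} → Incident A v r → v ∉ P′
      r-end∉P′ v∈r v∈P′ with incident-cases ℓ∈r v∈r | x∈p-y-z⁻ v∈P′
      ... | inj₁ refl | _ , v≢ℓ , _ = v≢ℓ refl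
      ... | inj₂ refl | _ , _ , v≢p = v≢p refl

      R-edge-at-ℓ-or-p : ∀ {r′ v} → r′ ∈ R → Incident A v r′ → v ≡ ℓ ⊎ v ≡ p → r′ ≡ r
      R-edge-at-ℓ-or-p r′∈R v∈r′ (inj₁ refl) = shared-vertex⇒≡ R-matching r′∈R r∈R v∈r′ ℓ∈r
      R-edge-at-ℓ-or-p r′∈R v∈r′ (inj₂ refl) = shared-vertex⇒≡ R-matching r′∈R r∈R v∈r′ p∈r

      neighbour-of-ℓ : ∀ {f y} → Incident A ℓ f → Incident A y f → y ≢ ℓ → y ∈ P → y ≡ p
      neighbour-of-ℓ ℓ∈f y∈f y≢ℓ y∈P with only-r _ (inside-edge ℓ∈f y∈f (≢-sym y≢ℓ) ℓ∈P y∈P) ℓ∈f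
      ... | refl = ≡-other ℓ∈r y∈f y≢ℓ

      P′-red : ∀ {v} → v ∈ P′ → Red v
      P′-red v∈P′ = P-red (⊆P v∈P′)

      P′-closed : R-closed P′
      P′-closed r′∈R v∈r′ w∈r′ v∈P′ with x∈p⇒x≡y⊎x≡z⊎x∈p-y-z ℓ p (P-closed r′∈R v∈r′ w∈r′ (⊆P v∈P′))
      ... | inj₂ (inj₂ w∈P′) = w∈P′
      ... | inj₁ w≡ℓ with R-edge-at-ℓ-or-p r′∈R w∈r′ (inj₁ w≡ℓ)
      ...   | refl = ⊥-elim (r-end∉P′ v∈r′ v∈P′)
      P′-closed r′∈R v∈r′ w∈r′ v∈P′ | inj₂ (inj₁ w≡p) with R-edge-at-ℓ-or-p r′∈R w∈r′ (inj₂ w≡p)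
      ...   | refl = ⊥-elim (r-end∉P′ v∈r′ v∈P′)

      extend : (∃[ K ] Transversal P′ q₁ q₂ K) → ∃[ K ] Transversal P q₁ q₂ K
      extend (K , t) = K ∪ ⁅ p ⁆ , record
        { K⊆P       = K′⊆P
        ; R-one-end = R-one-end′
        ; covers    = covers′
        ; q₁∈K      = required ℓ≢q₁ q₁∈K
        ; q₂∈K      = required ℓ≢q₂ q₂∈K
        }
        where
        open Transversal t
        K′⊆P : K ∪ ⁅ p ⁆ ⊆ P
        K′⊆P v∈ with x∈p∪⁅y⁆⁻ v∈
        ... | inj₁ v∈K = ⊆P (K⊆P v∈K)
        ... | inj₂ refl = p∈P
        R-one-end′ : ∀ {r′ v w} → r′ ∈ R → Incident A v r′ → Incident A w r′ → v ≢ w →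
                     v ∈ K ∪ ⁅ p ⁆ → w ∉ K ∪ ⁅ p ⁆
        R-one-end′ r′∈R v∈r′ w∈r′ v≢w v∈ w∈ with x∈p∪⁅y⁆⁻ v∈ | x∈p∪⁅y⁆⁻ w∈
        ... | inj₁ v∈K | inj₁ w∈K = R-one-end r′∈R v∈r′ w∈r′ v≢w v∈K w∈K
        ... | inj₂ refl | inj₂ refl = v≢w refl
        ... | inj₂ v≡p | inj₁ w∈K with R-edge-at-ℓ-or-p r′∈R v∈r′ (inj₂ v≡p)
        ...   | refl = r-end∉P′ w∈r′ (K⊆P w∈K)
        R-one-end′ r′∈R v∈r′ w∈r′ v≢w v∈ w∈ | inj₁ v∈K | inj₂ w≡p with R-edge-at-ℓ-or-p r′∈R w∈r′ (inj₂ w≡p)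
        ...   | refl = r-end∉P′ v∈r′ (K⊆P v∈K)
        covers′ : ∀ {e v w} → Incident A v e → Incident A w e → v ≢ w → v ∈ P → w ∈ P →
                  v ∈ K ∪ ⁅ p ⁆ ⊎ w ∈ K ∪ ⁅ p ⁆
        covers′ v∈e w∈e v≢w v∈P w∈P
          with x∈p⇒x≡y⊎x≡z⊎x∈p-y-z ℓ p v∈P | x∈p⇒x≡y⊎x≡z⊎x∈p-y-z ℓ p w∈P
        ... | inj₂ (inj₁ refl) | _ = inj₁ y∈p∪⁅y⁆
        ... | _ | inj₂ (inj₁ refl) = inj₂ y∈p∪⁅y⁆
        ... | inj₁ refl | _ = inj₂ (subst (_∈ K ∪ ⁅ p ⁆) (sym (neighbour-of-ℓ v∈e w∈e (≢-sym v≢w) w∈P)) y∈p∪⁅y⁆)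
        ... | _ | inj₁ refl = inj₁ (subst (_∈ K ∪ ⁅ p ⁆) (sym (neighbour-of-ℓ w∈e v∈e v≢w v∈P)) y∈p∪⁅y⁆)
        ... | inj₂ (inj₂ v∈P′) | inj₂ (inj₂ w∈P′) with covers v∈e w∈e v≢w v∈P′ w∈P′
        ...   | inj₁ v∈K = inj₁ (x∈p⇒x∈p∪⁅y⁆ v∈K)
        ...   | inj₂ w∈K = inj₂ (x∈p⇒x∈p∪⁅y⁆ w∈K)
        required : ∀ {q} → ℓ ≢ q → (q ∈ P′ → q ∈ K) → q ∈ P → q ∈ K ∪ ⁅ p ⁆
        required ℓ≢q q∈K q∈P with x∈p⇒x≡y⊎x≡z⊎x∈p-y-z ℓ p q∈P
        ... | inj₁ refl = ⊥-elim (ℓ≢q refl)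
        ... | inj₂ (inj₁ refl) = y∈p∪⁅y⁆
        ... | inj₂ (inj₂ q∈P′) = x∈p⇒x∈p∪⁅y⁆ (q∈K q∈P′)

    transversal : ∀ {P} → Acc _⊂_ P → (∀ {v} → v ∈ P → Red v) → R-closed P → ∃[ K ] Transversal P q₁ q₂ K
    transversal {P} (acc smaller) P-red P-closed with nonempty? P
    ... | no P-empty = ∅ , record
          { K⊆P       = λ v∈∅ → ⊥-elim (∉⊥ v∈∅)
          ; R-one-end = λ _ _ _ _ v∈∅ → ⊥-elim (∉⊥ v∈∅)
          ; covers    = λ _ _ _ v∈P → ⊥-elim (P-empty (_ , v∈P))
          ; q₁∈K      = λ q₁∈P → ⊥-elim (P-empty (_ , q₁∈P))
          ; q₂∈K      = λ q₂∈P → ⊥-elim (P-empty (_ , q₂∈P))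
          }
    ... | yes (u , u∈P) with Pick.RLeaf-avoiding P-red P-closed u∈P
    ...   | ℓ , ℓ∈P , ℓ≢q₁ , ℓ≢q₂ , r , r∈R , ℓ∈r , only-r =
            extend (transversal (smaller P′⊂P) P′-red P′-closed)
      where open Step P-red P-closed ℓ∈P ℓ≢q₁ ℓ≢q₂ r∈R ℓ∈r only-r

  module AvoidingMatching (g₀ : Fin n) where
    private
      saturating-B : ∃[ N ] Saturating g₀ B G N
      saturating-B = saturating g₀ (⊂-wellFounded B) (λ v∈B → v∈B) (λ v∈G → v∈G) B-joins-G-twice

    N : Subset m
    N = proj₁ saturating-B

    open Saturating (proj₂ saturating-B) public using (saturates)
    open Saturating (proj₂ saturating-B) using (edge-ends) renaming (matching to N-matching)

    M : Subset m
    M = R ∪ N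

    N-end : ∀ {f v} → f ∈ N → Incident A v f → v ∈ B ⊎ (v ∈ G × v ≢ g₀)
    N-end f∈N v∈f with edge-ends f∈N
    ... | b , g , b∈f , g∈f , b∈B , g∈G , g≢g₀ with incident-cases b∈f v∈f | incident-cases b∈f g∈f
    ...   | inj₁ refl | _ = inj₁ b∈B
    ...   | inj₂ _ | inj₁ refl = ⊥-elim (B∌G b∈B g∈G)
    ...   | inj₂ v≡o | inj₂ g≡o = inj₂ (subst (λ x → x ∈ G × x ≢ g₀) (trans g≡o (sym v≡o)) (g∈G , g≢g₀))

    N-G-end : ∀ {f} → f ∈ N → ∃[ g ] Incident A g f × g ∈ G × g ≢ g₀
    N-G-end f∈N = let (_ , g , _ , g∈f , _ , g∈G , g≢g₀) = edge-ends f∈N in g , g∈f , g∈G , g≢g₀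

    red∉N-end : ∀ {f v} → Red v → f ∈ N → ¬ Incident A v f
    red∉N-end red f∈N v∈f = [ (λ v∈B → B∌red v∈B red) , (λ (v∈G , _) → red∉G red v∈G) ]′ (N-end f∈N v∈f)

    is-matching : Matching A M
    is-matching e f e∈ f∈ e≢f v v∈e v∈f with x∈p∪q⁻ R N e∈ | x∈p∪q⁻ R N f∈
    ... | inj₁ e∈R | inj₁ f∈R = R-matching e f e∈R f∈R e≢f v v∈e v∈f
    ... | inj₂ e∈N | inj₂ f∈N = N-matching e f e∈N f∈N e≢f v v∈e v∈f
    ... | inj₁ e∈R | inj₂ f∈N = red∉N-end (e , e∈R , v∈e) f∈N v∈f
    ... | inj₂ e∈N | inj₁ f∈R = red∉N-end (f , f∈R , v∈f) e∈N v∈e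

    g₀-unmatched : g₀ ∈ G → ∀ e → e ∈ M → ¬ Incident A g₀ e
    g₀-unmatched g₀∈G e e∈ g₀∈e with x∈p∪q⁻ R N e∈
    ... | inj₁ e∈R = red∉G (e , e∈R , g₀∈e) g₀∈G
    ... | inj₂ e∈N = [ (λ g₀∈B → B∌G g₀∈B g₀∈G) , (λ (_ , g₀≢g₀) → g₀≢g₀ refl) ]′ (N-end e∈N g₀∈e)

  module CoverContaining {q₁ q₂} (compatible : Compatible q₁ q₂) where
    private
      transversal-of-reds : ∃[ K ] Transversal reds q₁ q₂ K
      transversal-of-reds =
        Transversals.transversal compatible (⊂-wellFounded reds) ∈reds⇒red (λ r∈R _ w∈r _ → red⇒∈reds (_ , r∈R , w∈r))

    K : Subset n
    K = proj₁ transversal-of-reds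

    open Transversal (proj₂ transversal-of-reds)

    C : Subset n
    C = B ∪ K

    K⊆red : ∀ {v} → v ∈ K → Red v
    K⊆red v∈K = ∈reds⇒red (K⊆P v∈K)

    red∈C⇒∈K : ∀ {v} → Red v → v ∈ C → v ∈ K
    red∈C⇒∈K red v∈C = [ (λ v∈B → ⊥-elim (B∌red v∈B red)) , (λ v∈K → v∈K) ]′ (x∈p∪q⁻ B K v∈C)

    C∌G : ∀ {v} → v ∈ C → v ∉ G
    C∌G v∈C v∈G = [ (λ v∈B → B∌G v∈B v∈G) , (λ v∈K → red∉G (K⊆red v∈K) v∈G) ]′ (x∈p∪q⁻ B K v∈C)

    q₁∈C : Red q₁ → q₁ ∈ C
    q₁∈C red = x∈p∪q⁺ (inj₂ (q₁∈K (red⇒∈reds red)))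

    q₂∈C : Red q₂ → q₂ ∈ C
    q₂∈C red = x∈p∪q⁺ (inj₂ (q₂∈K (red⇒∈reds red)))

    R-one-end-in-C : ∀ {r v w} → r ∈ R → Incident A v r → Incident A w r → v ≢ w → v ∈ C → w ∉ C
    R-one-end-in-C r∈R v∈r w∈r v≢w v∈C w∈C =
      R-one-end r∈R v∈r w∈r v≢w (red∈C⇒∈K (_ , r∈R , v∈r) v∈C) (red∈C⇒∈K (_ , r∈R , w∈r) w∈C)

    is-cover : VertexCover A C
    is-cover e with colour (end₁ A e) | colour (end₂ A e)
    ... | inj₁ e₁∈B | _ = inj₁ (x∈p∪q⁺ (inj₁ e₁∈B))
    ... | _ | inj₁ e₂∈B = inj₂ (x∈p∪q⁺ (inj₁ e₂∈B))
    ... | inj₂ (inj₂ e₁∈G) | _ = inj₂ (x∈p∪q⁺ (inj₁ (proj₁ (proj₁ (proj₂ iii) e) e₁∈G)))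
    ... | _ | inj₂ (inj₂ e₂∈G) = inj₁ (x∈p∪q⁺ (inj₁ (proj₂ (proj₁ (proj₂ iii) e) e₂∈G)))
    ... | inj₂ (inj₁ red₁) | inj₂ (inj₁ red₂)
      with covers (inj₁ refl) (inj₂ refl) (loopless e) (red⇒∈reds red₁) (red⇒∈reds red₂)
    ...   | inj₁ e₁∈K = inj₁ (x∈p∪q⁺ (inj₂ e₁∈K))
    ...   | inj₂ e₂∈K = inj₂ (x∈p∪q⁺ (inj₂ e₂∈K))

    ≤avoiding-matching : ∀ g₀ → ∣ C ∣ ≤ ∣ AvoidingMatching.M g₀ ∣
    ≤avoiding-matching g₀ = saturated⇒∣C∣≤∣M∣ saturated one-end
      where
      open AvoidingMatching g₀ using (N; M; saturates; N-G-end)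
      saturated : ∀ {v} → v ∈ C → ∃[ e ] e ∈ M × Incident A v e
      saturated v∈C with x∈p∪q⁻ B K v∈C
      ... | inj₁ v∈B = let (e , e∈N , v∈e) = saturates v∈B in e , x∈p∪q⁺ (inj₂ e∈N) , v∈e
      ... | inj₂ v∈K = let (e , e∈R , v∈e) = K⊆red v∈K in e , x∈p∪q⁺ (inj₁ e∈R) , v∈e
      one-end : ∀ {e} → e ∈ M → ¬ (end₁ A e ∈ C × end₂ A e ∈ C)
      one-end {e} e∈M (e₁∈C , e₂∈C) with x∈p∪q⁻ R N e∈M
      ... | inj₁ e∈R = R-one-end-in-C e∈R (inj₁ refl) (inj₂ refl) (loopless e) e₁∈C e₂∈C
      ... | inj₂ e∈N with N-G-end e∈N
      ...   | g , inj₁ refl , g∈G , _ = C∌G e₁∈C g∈G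
      ...   | g , inj₂ refl , g∈G , _ = C∌G e₂∈C g∈G

  cover-min : ∀ {q₁ q₂} (compatible : Compatible q₁ q₂) → MinVertexCover A (CoverContaining.C compatible)
  cover-min {q₁} compatible =
    CoverContaining.is-cover compatible , λ C′ cover′ →
      ≤-trans (CoverContaining.≤avoiding-matching compatible q₁)
              (matching≤cover (AvoidingMatching.is-matching q₁) cover′)

  matching-max : ∀ g₀ → MaxMatching A (AvoidingMatching.M g₀)
  matching-max g₀ =
    AvoidingMatching.is-matching g₀ , λ M′ matching′ →
      ≤-trans (matching≤cover matching′ (CoverContaining.is-cover (self-compatible g₀)))
              (CoverContaining.≤avoiding-matching (self-compatible g₀) g₀)

  -- König's theorem, in the direction needed; the vertex z is only used to build the witnesses.
  min≤max : ∀ {C M} → MinVertexCover A C → MaxMatching A M → Fin n → ∣ C ∣ ≤ ∣ M ∣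
  min≤max (_ , min) (_ , max) z =
    ≤-trans (min _ (CoverContaining.is-cover (self-compatible z)))
            (≤-trans (CoverContaining.≤avoiding-matching (self-compatible z) z)
                     (max _ (AvoidingMatching.is-matching z)))

  unmatched∉min-cover : ∀ {C M c} → MaxMatching A M → MinVertexCover A C →
                        (∀ e → e ∈ M → ¬ Incident A c e) → c ∉ C
  unmatched∉min-cover {c = c} max min = unmatched∉tight-cover (proj₁ max) (proj₁ min) (min≤max min max c)

  min-cover-one-end : ∀ {C M e} → MaxMatching A M → MinVertexCover A C → e ∈ M → ¬ (end₁ A e ∈ C × end₂ A e ∈ C)
  min-cover-one-end {e = e} max min = tight-cover-one-end (proj₁ max) (proj₁ min) (min≤max min max (end₁ A e))

  ∉G⇒∈cover-through-self : ∀ {v} → v ∉ G → v ∈ CoverContaining.C (self-compatible v)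
  ∉G⇒∈cover-through-self {v} v∉G with colour v
  ... | inj₁ v∈B = x∈p∪q⁺ (inj₁ v∈B)
  ... | inj₂ (inj₁ red) = CoverContaining.q₁∈C (self-compatible v) red
  ... | inj₂ (inj₂ v∈G) = ⊥-elim (v∉G v∈G)

  G⇒neg : ∀ {v} → v ∈ G → NegVBackbone A v
  G⇒neg {v} v∈G C min = unmatched∉min-cover (matching-max v) min (AvoidingMatching.g₀-unmatched v v∈G)

  neg⇒G : ∀ {v} → NegVBackbone A v → v ∈ G
  neg⇒G {v} neg with v ∈? G
  ... | yes v∈G = v∈G
  ... | no v∉G = ⊥-elim (neg _ (cover-min (self-compatible v)) (∉G⇒∈cover-through-self v∉G))

  B⇒pos : ∀ {v} → v ∈ B → PosVBackbone A v
  B⇒pos {v} v∈B C min with AvoidingMatching.saturates v v∈B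
  ... | e , e∈N , v∈e with AvoidingMatching.N-G-end v e∈N | covered-end (proj₁ min) e
  ...   | g , g∈e , g∈G , g≢v | x , x∈C , x∈e with incident-cases v∈e x∈e
  ...     | inj₁ refl = x∈C
  ...     | inj₂ x≡o = ⊥-elim (G⇒neg g∈G C min (subst (_∈ C) (trans x≡o (sym (≡-other v∈e g∈e g≢v))) x∈C))

  red⇒¬pos : ∀ {v} → Red v → ¬ PosVBackbone A v
  red⇒¬pos (r , r∈R , v∈r) pos =
    CoverContaining.R-one-end-in-C (self-compatible w) r∈R w∈r v∈r (other≢ v∈r)
      (CoverContaining.q₁∈C (self-compatible w) (r , r∈R , w∈r)) (pos _ (cover-min (self-compatible w)))
    where
    w : Fin n
    w = other v∈r
    w∈r : Incident A w r
    w∈r = other-incident v∈r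

  pos⇒B : ∀ {v} → PosVBackbone A v → v ∈ B
  pos⇒B {v} pos with colour v
  ... | inj₁ v∈B = v∈B
  ... | inj₂ (inj₁ red) = ⊥-elim (red⇒¬pos red pos)
  ... | inj₂ (inj₂ v∈G) = ⊥-elim (G⇒neg v∈G _ min (pos _ min))
    where
    min : MinVertexCover A (CoverContaining.C (self-compatible v))
    min = cover-min (self-compatible v)

  red⇔degenerate : ∀ {v} → Red v ⇔ Degenerate A v
  red⇔degenerate {v} = mk⇔ (λ red → red⇒¬pos red , λ neg → red∉G red (neg⇒G neg)) from
    where
    from : Degenerate A v → Red v
    from (¬pos , ¬neg) with colour v
    ... | inj₁ v∈B = ⊥-elim (¬pos (B⇒pos v∈B))
    ... | inj₂ (inj₁ red) = red
    ... | inj₂ (inj₂ v∈G) = ⊥-elim (¬neg (G⇒neg v∈G))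

  non-R-edge-at-red-in-min-cover : ∀ {f x} → f ∉ R → Incident A x f → Red x →
                                   ∃[ C ] MinVertexCover A C × end₁ A f ∈ C × end₂ A f ∈ C
  non-R-edge-at-red-in-min-cover {f} {x} f∉R x∈f x-red with colour (other x∈f)
  ... | inj₁ y∈B = _ , cover-min (self-compatible x) ,
        both-ends {P = _∈ CoverContaining.C (self-compatible x)} x∈f (other-incident x∈f) (≢other x∈f)
                  (CoverContaining.q₁∈C (self-compatible x) x-red) (x∈p∪q⁺ (inj₁ y∈B))
  ... | inj₂ (inj₁ y-red) = _ , cover-min compatible ,
        both-ends {P = _∈ CoverContaining.C compatible} x∈f (other-incident x∈f) (≢other x∈f)
                  (CoverContaining.q₁∈C compatible x-red) (CoverContaining.q₂∈C compatible y-red)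
    where
    compatible : Compatible x (other x∈f)
    compatible = inj₂ (f , f∉R , x∈f , other-incident x∈f)
  ... | inj₂ (inj₂ y∈G) = ⊥-elim (B∌red (G-neighbour∈B (other-incident x∈f) x∈f (other≢ x∈f) y∈G) x-red)

  max-matching-edge-at-red∈R : ∀ {M f x} → MaxMatching A M → f ∈ M → Incident A x f → Red x → f ∈ R
  max-matching-edge-at-red∈R {f = f} max f∈M x∈f x-red with f ∈? R
  ... | yes f∈R = f∈R
  ... | no f∉R = let (C , min , both) = non-R-edge-at-red-in-min-cover f∉R x∈f x-red
                 in ⊥-elim (min-cover-one-end max min f∈M both)

  R⊆max-matching : ∀ {M e} → MaxMatching A M → e ∈ R → e ∈ M
  R⊆max-matching {M} {e} max e∈R with e ∈? M
  ... | yes e∈M = e∈M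
  ... | no e∉M = ⊥-elim (unmatched∉min-cover max (cover-min (self-compatible u)) unmatched
                           (∉G⇒∈cover-through-self (red∉G u-red)))
    where
    u : Fin n
    u = end₁ A e
    u-red : Red u
    u-red = e , e∈R , inj₁ refl
    unmatched : ∀ f → f ∈ M → ¬ Incident A u f
    unmatched f f∈M u∈f =
      e∉M (subst (_∈ M) (shared-vertex⇒≡ R-matching (max-matching-edge-at-red∈R max f∈M u∈f u-red) e∈R u∈f (inj₁ refl)) f∈M)

  -- The G-end of an edge of N g₀ differs from g₀, but an edge has at most one G-end.
  posE⇒R : ∀ {e} → PosEBackbone A e → e ∈ R
  posE⇒R {e} pos with x∈p∪q⁻ R (AvoidingMatching.N (end₁ A e)) (pos _ (matching-max (end₁ A e)))
  ... | inj₁ e∈R = e∈R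
  ... | inj₂ e∈N with AvoidingMatching.N-G-end (end₁ A e) e∈N
  ...   | g , g∈e , g∈G , _ with x∈p∪q⁻ R (AvoidingMatching.N g) (pos _ (matching-max g))
  ...     | inj₁ e∈R = e∈R
  ...     | inj₂ e∈N′ with AvoidingMatching.N-G-end g e∈N′
  ...       | g′ , g′∈e , g′∈G , g′≢g = ⊥-elim (g′≢g (G-end-unique g′∈e g∈e g′∈G g∈G))

  R⇔exclusive : ∀ {e} → (e ∈ R) ⇔ Exclusive A e
  R⇔exclusive {e} = mk⇔ to from
    where
    to : e ∈ R → Exclusive A e
    to e∈R = Equivalence.to red⇔degenerate (e , e∈R , inj₁ refl) ,
             Equivalence.to red⇔degenerate (e , e∈R , inj₂ refl) ,
             λ C min → min-cover-one-end (matching-max (end₁ A e)) min (x∈p∪q⁺ (inj₁ e∈R))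
    from : Exclusive A e → e ∈ R
    from (degenerate₁ , _ , never-both) with e ∈? R
    ... | yes e∈R = e∈R
    ... | no e∉R =
          let (C , min , both) = non-R-edge-at-red-in-min-cover e∉R (inj₁ refl) (Equivalence.from red⇔degenerate degenerate₁)
          in ⊥-elim (never-both C min both)

  G⇔optional : ∀ {v} → (v ∈ G) ⇔ Optional A v
  G⇔optional {v} = mk⇔ (λ v∈G → _ , matching-max v , AvoidingMatching.g₀-unmatched v v∈G) from
    where
    from : Optional A v → v ∈ G
    from (M , max , unmatched) with v ∈? G
    ... | yes v∈G = v∈G
    ... | no v∉G = ⊥-elim (unmatched∉min-cover max (cover-min (self-compatible v)) unmatched
                             (∉G⇒∈cover-through-self v∉G))

  R⇔posE : ∀ {e} → (e ∈ R) ⇔ PosEBackbone A e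
  R⇔posE = mk⇔ (λ e∈R M max → R⊆max-matching max e∈R) posE⇒R

  B⇔unavoidable : ∀ {v} → (v ∈ B) ⇔ Unavoidable A v
  B⇔unavoidable {v} = mk⇔ to from
    where
    to : v ∈ B → Unavoidable A v
    to v∈B = (λ optional → B∌G v∈B (Equivalence.from G⇔optional optional)) ,
             λ (e , pos , v∈e) → B∌red v∈B (e , posE⇒R pos , v∈e)
    from : Unavoidable A v → v ∈ B
    from (¬optional , ¬pos) with colour v
    ... | inj₁ v∈B = v∈B
    ... | inj₂ (inj₁ (e , e∈R , v∈e)) = ⊥-elim (¬pos (e , Equivalence.to R⇔posE e∈R , v∈e))
    ... | inj₂ (inj₂ v∈G) = ⊥-elim (¬optional (Equivalence.to G⇔optional v∈G))

  prop-i : Prop-i A (B , R , G)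
  prop-i = (λ _ → mk⇔ B⇒pos pos⇒B) , (λ _ → R⇔exclusive) , (λ _ → mk⇔ G⇒neg neg⇒G)

  prop-ii : Prop-ii A (B , R , G)
  prop-ii = (λ _ → B⇔unavoidable) , (λ _ → R⇔posE) , (λ _ → G⇔optional)

Prop-i-unique : ∀ {n m} {A : Graph n m} {T T′ : Tricol A} → Prop-i A T → Prop-i A T′ → T ≡ T′
Prop-i-unique (B⇔ , R⇔ , G⇔) (B′⇔ , R′⇔ , G′⇔) =
  cong₂ _,_ (⇔-unique B⇔ B′⇔) (cong₂ _,_ (⇔-unique R⇔ R′⇔) (⇔-unique G⇔ G′⇔))

Prop-ii-unique : ∀ {n m} {A : Graph n m} {T T′ : Tricol A} → Prop-ii A T → Prop-ii A T′ → T ≡ T′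
Prop-ii-unique (B⇔ , R⇔ , G⇔) (B′⇔ , R′⇔ , G′⇔) =
  cong₂ _,_ (⇔-unique B⇔ B′⇔) (cong₂ _,_ (⇔-unique R⇔ R′⇔) (⇔-unique G⇔ G′⇔))

theorem1 : (n m : ℕ) (A : Graph n m) → IsTree A →
    Σ (Tricol A) λ T →
      IsTricoloring A T × Prop-i A T × Prop-ii A T × Prop-iii A T ×
      ((T′ : Tricol A) → IsTricoloring A T′ →
         (Prop-i A T′ ⊎ Prop-ii A T′ ⊎ Prop-iii A T′) → T′ ≡ T)
theorem1 n m A (_ , acyclic) with Existence.tricoloring-with-iii A acyclic
... | T , tricoloring , iii = T , tricoloring , prop-i , prop-ii , iii , unique
  where
  open FromProp-iii A acyclic tricoloring iii using (prop-i; prop-ii)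
  unique : (T′ : Tricol A) → IsTricoloring A T′ → (Prop-i A T′ ⊎ Prop-ii A T′ ⊎ Prop-iii A T′) → T′ ≡ T
  unique T′ _ (inj₁ i′) = Prop-i-unique {A = A} i′ prop-i
  unique T′ _ (inj₂ (inj₁ ii′)) = Prop-ii-unique {A = A} ii′ prop-ii
  unique T′ tricoloring′ (inj₂ (inj₂ iii′)) = Prop-i-unique {A = A} (FromProp-iii.prop-i A acyclic tricoloring′ iii′) prop-i
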